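{- If $p_\phi\in\mathrm{ST}$, then $p_\phi$ has a polynomial step count: there is a polynomial $P$ such that for every store $\mu$, every oracle $\phi$ and every derivation $\pi_\phi:\mu\models p_\phi\to w$, $|\pi_\phi|\le P(m_\mu^{p_\phi})$.
   Context: Words and programs. Fix a finite alphabet $\Sigma\supseteq\{0,1\}$ and let $\mathbb{W}=\Sigma^*$ ($\epsilon$ the empty word, $|w|$ the length of $w$); $v\unlhd w$ means $w=u.v.u'$ for some words $u,u'$. Fix a set $\mathbb{V}$ of variables and a set of operators, each operator $\mathtt{op}$ having an arity $ar(\mathtt{op})\ge 0$ and a total function $[\![\mathtt{op}]\!]:\mathbb{W}^{ar(\mathtt{op})}\to\mathbb{W}$. With a single oracle symbol $\phi$: expressions $e::=x\mid \mathtt{op}(e_1,\dots,e_{ar(\mathtt{op})})\mid \phi(e_1\upharpoonright e_2)$; commands $c::=\mathtt{skip}\mid x:=e\mid c_1;c_2\mid \mathtt{if}(e)\{c_1\}\,\mathtt{else}\,\{c_0\}\mid \mathtt{while}(e)\{c\}$; programs $p_\phi::=c\ \mathtt{return}\ x$. Semantics. For $w\in\mathbb{W}$, $n\in\mathbb{N}$, $w_{\upharpoonright n}$ is $w$ truncated to its first $\min(n,|w|)$ symbols followed by a word $10^k$ making the length exactly $n+1$; $[\![\upharpoonright]\!](v,w)=v_{\upharpoonright |w|}$. An oracle is a total function $\phi:\mathbb{W}\to\mathbb{W}$. A store is a partial map $\mu:\mathbb{V}\to\mathbb{W}$, of size $|\mu|=\sum_{x\in dom(\mu)}|\mu(x)|$;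 $\mu_0$ maps every variable to $\epsilon$. Given $\phi$, the deterministic big-step semantics is given by the rules: $\mu\models x\to\mu(x)$; $\mu\models\mathtt{op}(\bar e)\to[\![\mathtt{op}]\!](\bar w)$ if $\mu\models e_i\to w_i$ for all $i$; (oracle rule) $\mu\models\phi(e_1\upharpoonright e_2)\to\phi([\![\upharpoonright]\!](v,w))$ if $\mu\models e_1\to v$, $\mu\models e_2\to w$; $\mu\models\mathtt{skip}\to\mu$; $\mu\models x:=e\to\mu[x\leftarrow w]$ if $\mu\models e\to w$; $\mu\models c_1;c_2\to\mu_2$ if $\mu\models c_1\to\mu_1$ and $\mu_1\models c_2\to\mu_2$; $\mu\models\mathtt{if}(e)\{c_1\}\mathtt{else}\{c_0\}\to\mu'$ if $\mu\models e\to b$ with $b\in\{0,1\}$ and $\mu\models c_b\to\mu'$; $\mu\models\mathtt{while}(e)\{c\}\to\mu$ if $\mu\models e\to 0$; $\mu\models\mathtt{while}(e)\{c\}\to\mu'$ if $\mu\models e\to1$ and $\mu\models c;\mathtt{while}(e)\{c\}\to\mu'$; $\mu\models c\ \mathtt{return}\ x\to\mu'(x)$ if $\mu\models c\to\mu'$. A derivation $\pi_\phi$ is a proof tree built from these rules; $|\pi_\phi|$ is its number of nodes. $m_\mu^{p_\phi}$ is the maximum of $|\mu|$ and of the lengths $|\phi([\![\upharpoonright]\!](v,w))|$ over all applications of the oracle rule in $\pi_\phi:\mu\models p_\phi\to w$. A program whose variables are $x_1,\dots,x_n$ computes $[\![p_\phi]\!](w_1,\dots,w_n)=w$ iff $\mu_0[x_1\leftarrow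 w_1,\dots,x_n\leftarrow w_n]\models p_\phi\to w$; it is terminating if $[\![p_\phi]\!]$ is total for every oracle $\phi$. Operators. $\mathtt{op}$ is neutral if $ar(\mathtt{op})=0$, or $[\![\mathtt{op}]\!]$ takes values in $\{0,1\}$, or for all $\bar w$ there is $i$ with $[\![\mathtt{op}]\!](\bar w)\unlhd w_i$. $\mathtt{op}$ is positive if there is a constant $c$ with $|[\![\mathtt{op}]\!](\bar w)|\le\max_i|w_i|+c$ for all $\bar w$. Typing. Tiers are natural numbers $\mathbf 0,\mathbf 1,\dots$ with the usual order $\preceq$ (strict: $\prec$), $\vee=\max$, $\wedge=\min$. A variable typing environment $\Gamma$ maps variables to tiers; an operator typing environment $\Delta$ assigns to each operator $\mathtt{op}$ and tier $t$ a set $\Delta(\mathtt{op})(t)$ of types $t_1\to\dots\to t_{ar(\mathtt{op})}\to t'$. Judgments $\Gamma,\Delta\vdash b:(t,t_{in},t_{out})$ are derived by the rules (writing $\vdash$ for $\Gamma,\Delta\vdash$, all tiers arbitrary): (V) $\vdash x:(\Gamma(x),t_{in},t_{out})$; (OP) if $t_1\to\dots\to t_n\to t\in\Delta(\mathtt{op})(t_{in})$ and $\vdash e_i:(t_i,t_{in},t_{out})$ for all $i\le n=ar(\mathtt{op})$ then $\vdash\mathtt{op}(e_1,\dots,e_n):(t,t_{in},t_{out})$; (OR) if $\vdash e_1:(t,t_{in},t_{out})$, $\vdash e_2:(t_{out},t_{in},t_{out})$, $t\prec t_{in}$ and $t\preceq t_{out}$ then $\vdash\phi(e_1\upharpoonright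 e_2):(t,t_{in},t_{out})$; (SUB) for a command $c$, if $\vdash c:(t,t_{in},t_{out})$ then $\vdash c:(t+1,t_{in},t_{out})$; (SK) $\vdash\mathtt{skip}:(\mathbf0,t_{in},t_{out})$; (A) if $\vdash x:(t_1,t_{in},t_{out})$, $\vdash e:(t_2,t_{in},t_{out})$, $t_1\preceq t_2$ then $\vdash x:=e:(t_1,t_{in},t_{out})$; (S) if $\vdash c_1:\tau$ and $\vdash c_2:\tau$ then $\vdash c_1;c_2:\tau$; (C) if $\vdash e:\tau$, $\vdash c_1:\tau$, $\vdash c_0:\tau$ then $\vdash\mathtt{if}(e)\{c_1\}\mathtt{else}\{c_0\}:\tau$; (W) if $\vdash e:(t,t_{in},t_{out})$, $\vdash c:(t,t,t_{out})$ and $\mathbf1\preceq t\preceq t_{out}$ then $\vdash\mathtt{while}(e)\{c\}:(t,t_{in},t_{out})$; (W$_0$) if $\vdash e:(t,t_{in},t)$, $\vdash c:(t,t,t)$ and $\mathbf1\preceq t$ then $\vdash\mathtt{while}(e)\{c\}:(t,t_{in},\mathbf0)$. Safety. $\Delta$ is safe if for each operator $\mathtt{op}$ it types with $ar(\mathtt{op})>0$: $\mathtt{op}$ is neutral or positive, $[\![\mathtt{op}]\!]$ is polynomial-time computable, and for every tier $t_{in}$ and every $t_1\to\dots\to t_n\to t\in\Delta(\mathtt{op})(t_{in})$: $t\preceq\wedge_i t_i\preceq\vee_i t_i\preceq t_{in}$, and $t\prec t_{in}$ if $\mathtt{op}$ is positive but not neutral. A program $c\ \mathtt{return}\ x$ is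 safe if there are $\Gamma$, a safe $\Delta$ and tiers with $\Gamma,\Delta\vdash c:(t,t_{in},t_{out})$. $\mathrm{ST}$ is the set of safe and terminating programs. -}

module Defs where

open import Level using (Level; 0ℓ) renaming (suc to lsuc)
open import Data.Nat using (ℕ; zero; suc; _+_; _*_; _∸_; _≤_; _<_; _⊔_; _⊓_)
open import Data.Fin using (Fin; zero; suc; _≟_)
open import Data.List using (List; []; _∷_; _++_; length; take; replicate)
open import Data.Vec using (Vec; []; _∷_; lookup; tabulate)
import Data.Vec as V
open import Data.Maybe using (Maybe; just; nothing; maybe)
open import Data.Bool using (Bool; true; false; if_then_else_)
open import Data.Product using (Σ; ∃; ∃-syntax; _×_; _,_)
open import Data.Sum using (_⊎_)
open import Relation.Binary.PropositionalEquality using (_≡_)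
open import Relation.Nullary using (¬_; does)

Sym : ℕ → Set
Sym k = Fin (suc (suc k))

Word : ℕ → Set
Word k = List (Sym k)

s0 : {k : ℕ} → Sym k
s0 = zero

s1 : {k : ℕ} → Sym k
s1 = suc zero

bitW : {k : ℕ} → Bool → Word k
bitW false = s0 ∷ []
bitW true  = s1 ∷ []

trunc : {k : ℕ} → Word k → ℕ → Word k
trunc w n = take n w ++ (s1 ∷ replicate (n ∸ length w) s0)

restrict : {k : ℕ} → Word k → Word k → Word k
restrict v w = trunc v (length w)

_⊴_ : {k : ℕ} → Word k → Word k → Set
v ⊴ w = ∃[ u ] ∃[ u' ] (w ≡ u ++ v ++ u')

-- polynomials with natural coefficients (coefficient list, lowest degree first)
Poly : Set
Poly = List ℕ

evalPoly : Poly → ℕ → ℕ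
evalPoly []       x = 0
evalPoly (a ∷ as) x = a + x * evalPoly as x

⋁ : {n : ℕ} → Vec ℕ n → ℕ
⋁ []       = 0
⋁ (x ∷ xs) = x ⊔ ⋁ xs

-- (the value on the empty vector is irrelevant: only used when the arity is > 0)
⋀ : {n : ℕ} → Vec ℕ n → ℕ
⋀ []           = 0
⋀ (x ∷ [])     = x
⋀ (x ∷ y ∷ xs) = x ⊓ ⋀ (y ∷ xs)

record Lang : Set₁ where
  field
    k   : ℕ                 -- |Σ| = 2 + k
    nV  : ℕ
    Op  : Set
    ar  : Op → ℕ
    ⟦_⟧ : (o : Op) → Vec (Word k) (ar o) → Word k

module Sem (L : Lang) where
  open Lang L

  W : Set
  W = Word k

  Var : Set
  Var = Fin nV

  data Exp : Set where
    var : Var → Exp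
    op  : (o : Op) → Vec Exp (ar o) → Exp
    orc : Exp → Exp → Exp            -- φ(e₁ ↾ e₂)

  data Cmd : Set where
    skip   : Cmd
    _:=_   : Var → Exp → Cmd
    _⨾_    : Cmd → Cmd → Cmd
    ifte   : Exp → Cmd → Cmd → Cmd
    while  : Exp → Cmd → Cmd

  record Prog : Set where
    constructor _return_
    field
      body : Cmd
      ret  : Var
  open Prog public

  Store : Set
  Store = Var → Maybe W

  storeSize : Store → ℕ
  storeSize μ = V.sum (tabulate (λ x → maybe length 0 (μ x)))

  _[_←_] : Store → Var → W → Store
  (μ [ x ← w ]) y = if does (y ≟ x) then just w else μ y

  Oracle : Set
  Oracle = W → W

  data EvalE  (φ : Oracle) (μ : Store) : Exp → W → Set
  data EvalEs (φ : Oracle) (μ : Store) : {n : ℕ} → Vec Exp n → Vec W n → Set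

  data EvalE φ μ where
    evar : ∀ {x w} → μ x ≡ just w → EvalE φ μ (var x) w
    eop  : ∀ {o es ws} → EvalEs φ μ es ws → EvalE φ μ (op o es) (⟦ o ⟧ ws)
    eorc : ∀ {e₁ e₂ v w} → EvalE φ μ e₁ v → EvalE φ μ e₂ w →
           EvalE φ μ (orc e₁ e₂) (φ (restrict v w))

  data EvalEs φ μ where
    []  : EvalEs φ μ [] []
    _∷_ : ∀ {n e w} {es : Vec Exp n} {ws : Vec W n} →
          EvalE φ μ e w → EvalEs φ μ es ws → EvalEs φ μ (e ∷ es) (w ∷ ws)

  data EvalC (φ : Oracle) : Store → Cmd → Store → Set where
    cskip   : ∀ {μ} → EvalC φ μ skip μ
    cassign : ∀ {μ x e w} → EvalE φ μ e w → EvalC φ μ (x := e) (μ [ x ← w ])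
    cseq    : ∀ {μ μ₁ μ₂ c₁ c₂} → EvalC φ μ c₁ μ₁ → EvalC φ μ₁ c₂ μ₂ →
              EvalC φ μ (c₁ ⨾ c₂) μ₂
    cif     : ∀ {μ μ' e c₁ c₀} (b : Bool) → EvalE φ μ e (bitW b) →
              EvalC φ μ (if b then c₁ else c₀) μ' → EvalC φ μ (ifte e c₁ c₀) μ'
    cwhile0 : ∀ {μ e c} → EvalE φ μ e (bitW false) → EvalC φ μ (while e c) μ
    cwhile1 : ∀ {μ μ' e c} → EvalE φ μ e (bitW true) →
              EvalC φ μ (c ⨾ while e c) μ' → EvalC φ μ (while e c) μ'

  data EvalP (φ : Oracle) (μ : Store) (p : Prog) (w : W) : Set where
    eprog : ∀ {μ'} → EvalC φ μ (body p) μ' → μ' (ret p) ≡ just w → EvalP φ μ p w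

  sizeE  : ∀ {φ μ e w} → EvalE φ μ e w → ℕ
  sizeEs : ∀ {φ μ n} {es : Vec Exp n} {ws} → EvalEs φ μ es ws → ℕ
  sizeE (evar _)     = 1
  sizeE (eop ds)     = suc (sizeEs ds)
  sizeE (eorc d₁ d₂) = suc (sizeE d₁ + sizeE d₂)
  sizeEs []       = 0
  sizeEs (d ∷ ds) = sizeE d + sizeEs ds

  sizeC : ∀ {φ μ c μ'} → EvalC φ μ c μ' → ℕ
  sizeC cskip          = 1
  sizeC (cassign d)    = suc (sizeE d)
  sizeC (cseq d₁ d₂)   = suc (sizeC d₁ + sizeC d₂)
  sizeC (cif _ d d')   = suc (sizeE d + sizeC d')
  sizeC (cwhile0 d)    = suc (sizeE d)
  sizeC (cwhile1 d d') = suc (sizeE d + sizeC d')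

  sizeP : ∀ {φ μ p w} → EvalP φ μ p w → ℕ
  sizeP (eprog d _) = suc (sizeC d)

  orE  : ∀ {φ μ e w} → EvalE φ μ e w → ℕ
  orEs : ∀ {φ μ n} {es : Vec Exp n} {ws} → EvalEs φ μ es ws → ℕ
  orE (evar _) = 0
  orE (eop ds) = orEs ds
  orE {φ = φ} (eorc {v = v} {w = w} d₁ d₂) =
    length (φ (restrict v w)) ⊔ (orE d₁ ⊔ orE d₂)
  orEs []       = 0
  orEs (d ∷ ds) = orE d ⊔ orEs ds

  orC : ∀ {φ μ c μ'} → EvalC φ μ c μ' → ℕ
  orC cskip          = 0
  orC (cassign d)    = orE d
  orC (cseq d₁ d₂)   = orC d₁ ⊔ orC d₂
  orC (cif _ d d')   = orE d ⊔ orC d'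
  orC (cwhile0 d)    = orE d
  orC (cwhile1 d d') = orE d ⊔ orC d'

  orP : ∀ {φ μ p w} → EvalP φ μ p w → ℕ
  orP (eprog d _) = orC d

  mP : ∀ {φ μ p w} → EvalP φ μ p w → ℕ
  mP {μ = μ} π = storeSize μ ⊔ orP π

  Terminating : Prog → Set
  Terminating p = (φ : Oracle) (ν : Var → W) → ∃[ w ] EvalP φ (λ x → just (ν x)) p w

  OpEnv : Set₁
  OpEnv = (o : Op) → (tin : ℕ) → Vec ℕ (ar o) → ℕ → Set
  -- Δ o tin ts t  :  (ts₁ → … → tsₙ → t) ∈ Δ(o)(tin)

  module Typing (Γ : Var → ℕ) (Δ : OpEnv) where
    data TyE  : Exp → ℕ → ℕ → ℕ → Set
    data TyEs : {n : ℕ} → Vec Exp n → Vec ℕ n → ℕ → ℕ → Set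

    data TyE where
      tV  : ∀ {x tin tout} → TyE (var x) (Γ x) tin tout
      tOP : ∀ {o es ts t tin tout} → Δ o tin ts t → TyEs es ts tin tout →
            TyE (op o es) t tin tout
      tOR : ∀ {e₁ e₂ t tin tout} → TyE e₁ t tin tout → TyE e₂ tout tin tout →
            t < tin → t ≤ tout → TyE (orc e₁ e₂) t tin tout

    data TyEs where
      []  : ∀ {tin tout} → TyEs [] [] tin tout
      _∷_ : ∀ {n e t tin tout} {es : Vec Exp n} {ts} →
            TyE e t tin tout → TyEs es ts tin tout → TyEs (e ∷ es) (t ∷ ts) tin tout

    data TyC : Cmd → ℕ → ℕ → ℕ → Set where
      tSUB : ∀ {c t tin tout} → TyC c t tin tout → TyC c (suc t) tin tout
      tSK  : ∀ {tin tout} → TyC skip 0 tin tout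
      tA   : ∀ {x e t₁ t₂ tin tout} → TyE (var x) t₁ tin tout → TyE e t₂ tin tout →
             t₁ ≤ t₂ → TyC (x := e) t₁ tin tout
      tS   : ∀ {c₁ c₂ t tin tout} → TyC c₁ t tin tout → TyC c₂ t tin tout →
             TyC (c₁ ⨾ c₂) t tin tout
      tC   : ∀ {e c₁ c₀ t tin tout} → TyE e t tin tout → TyC c₁ t tin tout →
             TyC c₀ t tin tout → TyC (ifte e c₁ c₀) t tin tout
      tW   : ∀ {e c t tin tout} → TyE e t tin tout → TyC c t t tout →
             1 ≤ t → t ≤ tout → TyC (while e c) t tin tout
      tW0  : ∀ {e c t tin} → TyE e t tin t → TyC c t t t → 1 ≤ t →
             TyC (while e c) t tin 0

  maxLen : {n : ℕ} → Vec W n → ℕ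
  maxLen []       = 0
  maxLen (w ∷ ws) = length w ⊔ maxLen ws

  Neutral : Op → Set
  Neutral o = (ar o ≡ 0)
            ⊎ (∀ ws → (⟦ o ⟧ ws ≡ bitW false) ⊎ (⟦ o ⟧ ws ≡ bitW true))
            ⊎ (∀ ws → ∃[ i ] (⟦ o ⟧ ws ⊴ lookup ws i))

  Positive : Op → Set
  Positive o = ∃[ c ] (∀ ws → length (⟦ o ⟧ ws) ≤ maxLen ws + c)

  PolyTimePred : Set₁
  PolyTimePred = (n : ℕ) → (Vec W n → W) → Set

  SafeOpEnv : PolyTimePred → OpEnv → Set
  SafeOpEnv PT Δ =
    ∀ (o : Op) → (∃[ tin ] ∃[ ts ] ∃[ t ] Δ o tin ts t) → 0 < ar o →
      (Neutral o ⊎ Positive o)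
      × PT (ar o) ⟦ o ⟧
      × (∀ tin ts t → Δ o tin ts t →
           (t ≤ ⋀ ts) × (⋀ ts ≤ ⋁ ts) × (⋁ ts ≤ tin)
           × (Positive o → ¬ Neutral o → t < tin))

  Safe : PolyTimePred → Prog → Set₁
  Safe PT p = ∃[ Γ ] ∃[ Δ ] ∃[ t ] ∃[ tin ] ∃[ tout ]
                (SafeOpEnv PT Δ × Typing.TyC Γ Δ (body p) t tin tout)

  ST : PolyTimePred → Prog → Set₁
  ST PT p = Safe PT p × Terminating p

-- Tiering gives non-interference: the tier-u part of the store determines the rest of a
-- loop of tier u, so the stores at successive tests of its guard have pairwise distinct
-- tier-u parts. At tiers at least the input tier no oracle is called and every operator
-- is neutral, so tier-u values are factors of the initial tier-u values, of the program
-- constants and of the two bits; hence a loop of tier u iterates at most polynomially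
-- often in the size N u of the tier-u part of the store. A command never increases N s
-- at tiers s above its own, and below them increases it by at most a polynomial in
-- N (s + 1). Induction on the typing derivation, descending through the tiers at each
-- loop, turns these facts into polynomial bounds on all store sizes and hence on the
-- size of the derivation.

module Submission where

open import Defs
open import Data.Bool using (Bool; true; false; if_then_else_)
open import Data.Fin as Fin using (Fin; zero; suc; toℕ; fromℕ; funToFin; finToFun)
open import Data.Fin.Properties using (pigeonhole; finToFun-funToFin; toℕ≤pred[n])
open import Data.List as List using (List; []; _∷_; map; _++_; length; allFin)
open import Data.List.Extrema.Nat using (max; v≤max⁺; max≤v⁺; xs≤max)
open import Data.List.Membership.DecPropositional as DecMembership using ()
open import Data.List.Membership.Propositional using (_∈_)
open import Data.List.Membership.Propositional.Properties
  using (∈-++⁺ˡ; ∈-++⁺ʳ; ∈-++⁻; ∈-map⁺; ∈-map⁻; ∈-allFin)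
open import Data.List.Properties
  using (≡-dec; ++-assoc; ++-identityʳ; length-++; length-++-≤ˡ; length-map; length-tabulate)
open import Data.List.Relation.Binary.Subset.Propositional using (_⊆_)
open import Data.List.Relation.Unary.All as All using ()
open import Data.List.Relation.Unary.Any as Any using (here; there)
open import Data.List.Relation.Unary.Any.Properties using (lookup-index)
open import Data.Maybe using (Maybe; just; nothing; fromMaybe; maybe)
open import Data.Maybe.Properties using (just-injective)
open import Data.Nat
  using (ℕ; zero; suc; pred; _+_; _*_; _∸_; _^_; _⊔_; _≤_; _<_; _≟_; _≤?_; z≤n; s≤s)
open import Data.Nat.Properties
open import Data.Nat.Tactic.RingSolver using (solve-∀)
open import Data.Product using (∃; ∃-syntax; ∃₂; _×_; _,_; proj₁; proj₂)
open import Data.Sum using (_⊎_; inj₁; inj₂; [_,_]′)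
open import Data.Vec as Vec using (Vec; []; _∷_)
open import Data.Vec.Relation.Unary.All as Allᵛ using ([]; _∷_) renaming (All to Allᵛ)
open import Data.Vec.Relation.Unary.All.Properties using (lookup⁺)
open import Function using (_∘_; id)
open import Relation.Binary.PropositionalEquality
open import Relation.Nullary using (yes; no; ¬_; contradiction)
open import Relation.Nullary.Decidable using (decidable-stable)

-- Polynomials

infixl 6 _+ᴾ_
infixl 7 _*ᴾ_ _·ᴾ_

_+ᴾ_ : Poly → Poly → Poly
[]      +ᴾ q       = q
p       +ᴾ []      = p
(a ∷ p) +ᴾ (b ∷ q) = a + b ∷ p +ᴾ q

_·ᴾ_ : ℕ → Poly → Poly
a ·ᴾ p = map (a *_) p

_*ᴾ_ : Poly → Poly → Poly
[]      *ᴾ q = []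
(a ∷ p) *ᴾ q = a ·ᴾ q +ᴾ (0 ∷ p *ᴾ q)

_∘ᴾ_ : Poly → Poly → Poly
[]      ∘ᴾ q = []
(a ∷ p) ∘ᴾ q = (a ∷ []) +ᴾ q *ᴾ (p ∘ᴾ q)

evalPoly-+ᴾ : ∀ p q x → evalPoly (p +ᴾ q) x ≡ evalPoly p x + evalPoly q x
evalPoly-+ᴾ []      q       x = refl
evalPoly-+ᴾ (a ∷ p) []      x = sym (+-identityʳ _)
evalPoly-+ᴾ (a ∷ p) (b ∷ q) x
  rewrite evalPoly-+ᴾ p q x = interchange a b x (evalPoly p x) (evalPoly q x)
  where
  interchange : ∀ a b x m n → a + b + x * (m + n) ≡ a + x * m + (b + x * n)
  interchange = solve-∀

evalPoly-·ᴾ : ∀ a p x → evalPoly (a ·ᴾ p) x ≡ a * evalPoly p x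
evalPoly-·ᴾ a []      x = sym (*-zeroʳ a)
evalPoly-·ᴾ a (b ∷ p) x
  rewrite evalPoly-·ᴾ a p x = distrib a b x (evalPoly p x)
  where
  distrib : ∀ a b x m → a * b + x * (a * m) ≡ a * (b + x * m)
  distrib = solve-∀

evalPoly-*ᴾ : ∀ p q x → evalPoly (p *ᴾ q) x ≡ evalPoly p x * evalPoly q x
evalPoly-*ᴾ []      q x = refl
evalPoly-*ᴾ (a ∷ p) q x
  rewrite evalPoly-+ᴾ (a ·ᴾ q) (0 ∷ p *ᴾ q) x | evalPoly-·ᴾ a q x | evalPoly-*ᴾ p q x
  = distrib a x (evalPoly p x) (evalPoly q x)
  where
  distrib : ∀ a x m n → a * n + x * (m * n) ≡ (a + x * m) * n
  distrib = solve-∀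

evalPoly-∘ᴾ : ∀ p q x → evalPoly (p ∘ᴾ q) x ≡ evalPoly p (evalPoly q x)
evalPoly-∘ᴾ []      q x = refl
evalPoly-∘ᴾ (a ∷ p) q x
  rewrite evalPoly-+ᴾ (a ∷ []) (q *ᴾ (p ∘ᴾ q)) x | evalPoly-*ᴾ q (p ∘ᴾ q) x | evalPoly-∘ᴾ p q x
  = cong (_+ _) (trans (cong (a +_) (*-zeroʳ x)) (+-identityʳ a))

-- Polynomial expressions are evaluated by structural recursion, so bounds
-- built from them unfold definitionally; they become coefficient lists only
-- at the very end.

infixl 6 _⊕_
infixl 7 _⊗_
infixr 9 _⊚_

data PolyTerm : Set where
  con         : ℕ → PolyTerm
  X           : PolyTerm
  _⊕_ _⊗_ _⊚_ : PolyTerm → PolyTerm → PolyTerm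

⟦_⟧ₚ : PolyTerm → ℕ → ℕ
⟦ con c ⟧ₚ x = c
⟦ X     ⟧ₚ x = x
⟦ p ⊕ q ⟧ₚ x = ⟦ p ⟧ₚ x + ⟦ q ⟧ₚ x
⟦ p ⊗ q ⟧ₚ x = ⟦ p ⟧ₚ x * ⟦ q ⟧ₚ x
⟦ p ⊚ q ⟧ₚ x = ⟦ p ⟧ₚ (⟦ q ⟧ₚ x)

⟦⟧ₚ-mono : ∀ p {x y} → x ≤ y → ⟦ p ⟧ₚ x ≤ ⟦ p ⟧ₚ y
⟦⟧ₚ-mono (con c) x≤y = ≤-refl
⟦⟧ₚ-mono X       x≤y = x≤y
⟦⟧ₚ-mono (p ⊕ q) x≤y = +-mono-≤ (⟦⟧ₚ-mono p x≤y) (⟦⟧ₚ-mono q x≤y)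
⟦⟧ₚ-mono (p ⊗ q) x≤y = *-mono-≤ (⟦⟧ₚ-mono p x≤y) (⟦⟧ₚ-mono q x≤y)
⟦⟧ₚ-mono (p ⊚ q) x≤y = ⟦⟧ₚ-mono p (⟦⟧ₚ-mono q x≤y)

infixr 8 _^ₚ_

_^ₚ_ : PolyTerm → ℕ → PolyTerm
p ^ₚ zero  = con 1
p ^ₚ suc n = p ⊗ p ^ₚ n

⟦^ₚ⟧ : ∀ p n x → ⟦ p ^ₚ n ⟧ₚ x ≡ ⟦ p ⟧ₚ x ^ n
⟦^ₚ⟧ p zero    x = refl
⟦^ₚ⟧ p (suc n) x = cong (⟦ p ⟧ₚ x *_) (⟦^ₚ⟧ p n x)

toPoly : PolyTerm → Poly
toPoly (con c) = c ∷ []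
toPoly X       = 0 ∷ 1 ∷ []
toPoly (p ⊕ q) = toPoly p +ᴾ toPoly q
toPoly (p ⊗ q) = toPoly p *ᴾ toPoly q
toPoly (p ⊚ q) = toPoly p ∘ᴾ toPoly q

evalPoly-toPoly : ∀ p x → evalPoly (toPoly p) x ≡ ⟦ p ⟧ₚ x
evalPoly-toPoly (con c) x = trans (cong (c +_) (*-zeroʳ x)) (+-identityʳ c)
evalPoly-toPoly X       x = trans (cong (λ y → x * suc y) (*-zeroʳ x)) (*-identityʳ x)
evalPoly-toPoly (p ⊕ q) x = trans (evalPoly-+ᴾ (toPoly p) (toPoly q) x)
                                  (cong₂ _+_ (evalPoly-toPoly p x) (evalPoly-toPoly q x))
evalPoly-toPoly (p ⊗ q) x = trans (evalPoly-*ᴾ (toPoly p) (toPoly q) x)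
                                  (cong₂ _*_ (evalPoly-toPoly p x) (evalPoly-toPoly q x))
evalPoly-toPoly (p ⊚ q) x = trans (evalPoly-∘ᴾ (toPoly p) (toPoly q) x)
                                  (trans (cong (evalPoly (toPoly p)) (evalPoly-toPoly q x))
                                         (evalPoly-toPoly p (⟦ q ⟧ₚ x)))

-- Factors of words

module _ {k : ℕ} where

  ⊴-refl : (w : Word k) → w ⊴ w
  ⊴-refl w = [] , [] , sym (++-identityʳ w)

  ⊴-trans : {u v w : Word k} → u ⊴ v → v ⊴ w → u ⊴ w
  ⊴-trans {u} (a , a' , refl) (b , b' , refl) =
    b ++ a , a' ++ b' , assoc
    where
    assoc : b ++ (a ++ u ++ a') ++ b' ≡ (b ++ a) ++ u ++ a' ++ b'
    assoc = begin
      b ++ (a ++ u ++ a') ++ b'  ≡⟨ cong (b ++_) (++-assoc a (u ++ a') b') ⟩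
      b ++ a ++ (u ++ a') ++ b'  ≡⟨ cong (λ z → b ++ a ++ z) (++-assoc u a' b') ⟩
      b ++ a ++ u ++ a' ++ b'    ≡⟨ ++-assoc b a _ ⟨
      (b ++ a) ++ u ++ a' ++ b'  ∎
      where open ≡-Reasoning

  ⊴-length : {v w : Word k} → v ⊴ w → length v ≤ length w
  ⊴-length {v} (u , u' , refl) = begin
    length v                     ≤⟨ m≤n+m (length v) (length u) ⟩
    length u + length v          ≤⟨ +-monoʳ-≤ (length u) (length-++-≤ˡ v) ⟩
    length u + length (v ++ u')  ≡⟨ length-++ u ⟨
    length (u ++ v ++ u')        ∎
    where open ≤-Reasoning

  prefixes : Word k → List (Word k)
  prefixes []      = [] ∷ []
  prefixes (a ∷ w) = [] ∷ map (a ∷_) (prefixes w)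

  factors : Word k → List (Word k)
  factors []      = [] ∷ []
  factors (a ∷ w) = prefixes (a ∷ w) ++ factors w

  ∈-prefixes⁺ : ∀ v u' → v ∈ prefixes (v ++ u')
  ∈-prefixes⁺ []      []       = here refl
  ∈-prefixes⁺ []      (_ ∷ _)  = here refl
  ∈-prefixes⁺ (a ∷ v) u'       = there (∈-map⁺ (a ∷_) (∈-prefixes⁺ v u'))

  ∈-prefixes⁻ : ∀ {v} w → v ∈ prefixes w → ∃[ u' ] w ≡ v ++ u'
  ∈-prefixes⁻ []      (here refl) = [] , refl
  ∈-prefixes⁻ (a ∷ w) (here refl) = a ∷ w , refl
  ∈-prefixes⁻ (a ∷ w) (there v∈) with ∈-map⁻ (a ∷_) v∈
  ... | v' , v'∈ , refl with ∈-prefixes⁻ w v'∈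
  ...   | u' , refl = u' , refl

  ∈-factors⁺ : ∀ {v w} → v ⊴ w → v ∈ factors w
  ∈-factors⁺ {v} ([] , u' , refl) with v ++ u' | ∈-prefixes⁺ v u'
  ... | []    | v∈ = v∈
  ... | _ ∷ _ | v∈ = ∈-++⁺ˡ v∈
  ∈-factors⁺ {v} (a ∷ u , u' , refl) =
    ∈-++⁺ʳ (prefixes (a ∷ u ++ v ++ u')) (∈-factors⁺ (u , u' , refl))

  ∈-factors⁻ : ∀ {v} w → v ∈ factors w → v ⊴ w
  ∈-factors⁻ []      (here refl) = ⊴-refl []
  ∈-factors⁻ (a ∷ w) v∈ with ∈-++⁻ (prefixes (a ∷ w)) v∈
  ... | inj₁ v∈pre = let (u' , eq) = ∈-prefixes⁻ (a ∷ w) v∈pre in [] , u' , eq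
  ... | inj₂ v∈fac = let (u , u' , eq) = ∈-factors⁻ w v∈fac in a ∷ u , u' , cong (a ∷_) eq

  length-prefixes : ∀ w → length (prefixes w) ≡ suc (length w)
  length-prefixes []      = refl
  length-prefixes (a ∷ w) = cong suc (trans (length-map (a ∷_) (prefixes w)) (length-prefixes w))

  length-factors : ∀ w → length (factors w) ≤ suc (length w) * suc (length w)
  length-factors []      = ≤-refl
  length-factors (a ∷ w) = begin
    length (prefixes (a ∷ w) ++ factors w)          ≡⟨ length-++ (prefixes (a ∷ w)) ⟩
    length (prefixes (a ∷ w)) + m                   ≡⟨ cong (_+ m) (length-prefixes (a ∷ w)) ⟩
    2 + n + m                                       ≤⟨ +-monoʳ-≤ (2 + n) (length-factors w) ⟩
    2 + n + suc n * suc n                           ≤⟨ m≤m+n _ (suc n) ⟩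
    2 + n + suc n * suc n + suc n                   ≡⟨ square (length w) ⟩
    suc (suc n) * suc (suc n)                       ∎
    where
    n = length w
    m = length (factors w)
    open ≤-Reasoning
    square : ∀ n → 2 + n + suc n * suc n + suc n ≡ suc (suc n) * suc (suc n)
    square = solve-∀

  factorsOf : List (Word k) → List (Word k)
  factorsOf []      = []
  factorsOf (s ∷ S) = factors s ++ factorsOf S

  ∈-factorsOf⁺ : ∀ {v s S} → v ⊴ s → s ∈ S → v ∈ factorsOf S
  ∈-factorsOf⁺ v⊴s (here refl) = ∈-++⁺ˡ (∈-factors⁺ v⊴s)
  ∈-factorsOf⁺ {S = s' ∷ S} v⊴s (there s∈) = ∈-++⁺ʳ (factors s') (∈-factorsOf⁺ v⊴s s∈)

  ∈-factorsOf⁻ : ∀ {v} S → v ∈ factorsOf S → ∃[ s ] s ∈ S × v ⊴ s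
  ∈-factorsOf⁻ (s ∷ S) v∈ with ∈-++⁻ (factors s) v∈
  ... | inj₁ v∈s = s , here refl , ∈-factors⁻ s v∈s
  ... | inj₂ v∈S = let (s' , s'∈ , v⊴s') = ∈-factorsOf⁻ S v∈S in s' , there s'∈ , v⊴s'

  factorsOf-⊴-closed : ∀ {u v} S → u ⊴ v → v ∈ factorsOf S → u ∈ factorsOf S
  factorsOf-⊴-closed S u⊴v v∈ =
    let (s , s∈ , v⊴s) = ∈-factorsOf⁻ S v∈ in ∈-factorsOf⁺ (⊴-trans u⊴v v⊴s) s∈

  LengthsBelow : ℕ → List (Word k) → Set
  LengthsBelow n S = ∀ {s} → s ∈ S → length s ≤ n

  factorsOf-lengthsBelow : ∀ {n} S → LengthsBelow n S → LengthsBelow n (factorsOf S)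
  factorsOf-lengthsBelow S short v∈ =
    let (s , s∈ , v⊴s) = ∈-factorsOf⁻ S v∈ in ≤-trans (⊴-length v⊴s) (short s∈)

  length-factorsOf : ∀ {n} S → LengthsBelow n S →
                     length (factorsOf S) ≤ length S * (suc n * suc n)
  length-factorsOf []      short = z≤n
  length-factorsOf (s ∷ S) short = begin
    length (factors s ++ factorsOf S)             ≡⟨ length-++ (factors s) ⟩
    length (factors s) + length (factorsOf S)     ≤⟨ +-mono-≤ (length-factors s)
                                                       (length-factorsOf S (short ∘ there)) ⟩
    suc (length s) * suc (length s) + _           ≤⟨ +-monoˡ-≤ _ (*-mono-≤ sn sn) ⟩
    _ + length S * _                              ∎
    where
    open ≤-Reasoning
    sn = s≤s (short (here refl))

pigeonhole-→ : ∀ {m n k} → k ^ n < m → (f : Fin m → Fin n → Fin k) →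
               ∃₂ λ i j → i Fin.< j × f i ≗ f j
pigeonhole-→ k^n<m f =
  let (i , j , i<j , codes≡) = pigeonhole k^n<m (funToFin ∘ f)
  in  i , j , i<j , λ x → begin
        f i x                       ≡⟨ finToFun-funToFin (f i) x ⟨
        finToFun (funToFin (f i)) x ≡⟨ cong (λ c → finToFun c x) codes≡ ⟩
        finToFun (funToFin (f j)) x ≡⟨ finToFun-funToFin (f j) x ⟩
        f j x                       ∎
  where open ≡-Reasoning

⋀-lowerBound : ∀ {n t} (ts : Vec ℕ n) → t ≤ ⋀ ts → Allᵛ (t ≤_) ts
⋀-lowerBound []           _   = []
⋀-lowerBound (x ∷ [])     t≤  = t≤ ∷ []
⋀-lowerBound (x ∷ y ∷ ts) t≤  =
  ≤-trans t≤ (m⊓n≤m x _) ∷ ⋀-lowerBound (y ∷ ts) (≤-trans t≤ (m⊓n≤n x _))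

≤-sum-tabulate : ∀ {n} (f : Fin n → ℕ) i → f i ≤ Vec.sum (Vec.tabulate f)
≤-sum-tabulate f zero    = m≤m+n _ _
≤-sum-tabulate f (suc i) = ≤-trans (≤-sum-tabulate (f ∘ suc) i) (m≤n+m _ (f zero))

module Derivations (L : Lang) where
  open Lang L
  open Sem L

  update-other : ∀ (μ : Store) {x y} w → y ≢ x → (μ [ x ← w ]) y ≡ μ y
  update-other μ {x} {y} w y≢x with y Fin.≟ x
  ... | yes y≡x = contradiction y≡x y≢x
  ... | no _    = refl

  length≤storeSize : ∀ {μ : Store} {x v} → μ x ≡ just v → length v ≤ storeSize μ
  length≤storeSize {μ} {x} μx≡v =
    subst (_≤ storeSize μ) (cong (maybe length 0) μx≡v) (≤-sum-tabulate (maybe length 0 ∘ μ) x)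

  bitW-injective : ∀ {b b'} → bitW {k} b ≡ bitW b' → b ≡ b'
  bitW-injective {false} {false} _ = refl
  bitW-injective {true}  {true}  _ = refl

  expSize : Exp → ℕ
  expsSize : ∀ {n} → Vec Exp n → ℕ
  expSize (var x)   = 1
  expSize (op o es) = suc (expsSize es)
  expSize (orc a b) = suc (expSize a + expSize b)
  expsSize []       = 0
  expsSize (e ∷ es) = expSize e + expsSize es

  sizeE≡expSize : ∀ {φ μ e w} (d : EvalE φ μ e w) → sizeE d ≡ expSize e
  sizeEs≡expsSize : ∀ {φ μ n} {es : Vec Exp n} {ws} (ds : EvalEs φ μ es ws) →
                    sizeEs ds ≡ expsSize es
  sizeE≡expSize (evar _)     = refl
  sizeE≡expSize (eop ds)     = cong suc (sizeEs≡expsSize ds)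
  sizeE≡expSize (eorc d₁ d₂) = cong suc (cong₂ _+_ (sizeE≡expSize d₁) (sizeE≡expSize d₂))
  sizeEs≡expsSize []       = refl
  sizeEs≡expsSize (d ∷ ds) = cong₂ _+_ (sizeE≡expSize d) (sizeEs≡expsSize ds)

  module Loops {φ : Oracle} where

    Loop : Exp → Cmd → Store → Store → Set
    Loop e c μ μ' = EvalC φ μ (while e c) μ'

    iterations : ∀ {e c μ μ'} → Loop e c μ μ' → ℕ
    iterations (cwhile0 _)            = 0
    iterations (cwhile1 _ (cseq _ r)) = suc (iterations r)

    suffix : ∀ {e c μ μ'} (r : Loop e c μ μ') → Fin (suc (iterations r)) →
             ∃[ ν ] Loop e c ν μ'
    suffix {μ = μ} r zero               = μ , r
    suffix (cwhile1 _ (cseq _ r)) (suc i) = suffix r i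

    headAt : ∀ {e c μ μ'} (r : Loop e c μ μ') → Fin (suc (iterations r)) → Store
    headAt r i = proj₁ (suffix r i)

    iterations-suffix : ∀ {e c μ μ'} (r : Loop e c μ μ') i →
                        toℕ i + iterations (proj₂ (suffix r i)) ≡ iterations r
    iterations-suffix r                      zero    = refl
    iterations-suffix (cwhile1 _ (cseq _ r)) (suc i) = cong suc (iterations-suffix r i)

    headAt-last : ∀ {e c μ μ'} (r : Loop e c μ μ') → headAt r (fromℕ (iterations r)) ≡ μ'
    headAt-last (cwhile0 _)            = refl
    headAt-last (cwhile1 _ (cseq _ r)) = headAt-last r

    AllHeads : ∀ {e c μ μ'} → (Store → Set) → Loop e c μ μ' → Set
    AllHeads P r = ∀ i → P (headAt r i)

    orC-body≤ : ∀ {e c μ μ₁ μ'} g (d : EvalC φ μ c μ₁) (r : Loop e c μ₁ μ') →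
                orC d ≤ orC (cwhile1 g (cseq d r))
    orC-body≤ g d r = ≤-trans (m≤m⊔n (orC d) (orC r)) (m≤n⊔m (orE g) _)

    orC-rest≤ : ∀ {e c μ μ₁ μ'} g (d : EvalC φ μ c μ₁) (r : Loop e c μ₁ μ') →
                orC r ≤ orC (cwhile1 g (cseq d r))
    orC-rest≤ g d r = ≤-trans (m≤n⊔m (orC d) (orC r)) (m≤n⊔m (orE g) _)

    heads-invariant : ∀ {e c μ μ'} (P : Store → Set) →
      (∀ {ν ν'} → EvalC φ ν c ν' → P ν → P ν') →
      (r : Loop e c μ μ') → P μ → AllHeads P r
    heads-invariant P step r p zero = p
    heads-invariant P step (cwhile1 _ (cseq d r)) p (suc i) = heads-invariant P step r (step d p) i

    heads-linear : ∀ {e c μ μ' B} (P : Store → Set) (f : Store → ℕ) (G : ℕ) →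
      (∀ {ν ν'} (d : EvalC φ ν c ν') → orC d ≤ B → P ν → f ν' ≤ f ν + G) →
      (r : Loop e c μ μ') → orC r ≤ B → AllHeads P r →
      ∀ i → f (headAt r i) ≤ f μ + toℕ i * G
    heads-linear P f G step r ob ps zero = m≤m+n _ 0
    heads-linear {μ = μ} P f G step (cwhile1 g (cseq d r)) ob ps (suc i) = begin
      f (headAt r i)                ≤⟨ heads-linear P f G step r (≤-trans (orC-rest≤ g d r) ob)
                                         (ps ∘ suc) i ⟩
      f (headAt r zero) + toℕ i * G ≤⟨ +-monoˡ-≤ _ (step d (≤-trans (orC-body≤ g d r) ob)
                                                          (ps zero)) ⟩
      f μ + G + toℕ i * G           ≡⟨ +-assoc (f μ) G _ ⟩
      f μ + toℕ (suc i) * G         ∎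
      where open ≤-Reasoning

module Analysis (L : Lang) {PT : Sem.PolyTimePred L} (Γ : Fin (Lang.nV L) → ℕ)
                (Δ : Sem.OpEnv L) (safe : Sem.SafeOpEnv L PT Δ) where
  open Lang L
  open Sem L
  open Typing Γ Δ
  open Derivations L
  open DecMembership (≡-dec (Fin._≟_ {suc (suc k)})) using (_∈?_)

  nullary⊎hasArguments : (o : Op) → ar o ≡ 0 ⊎ 0 < ar o
  nullary⊎hasArguments o with ar o ≟ 0
  ... | yes ar≡0 = inj₁ ar≡0
  ... | no  ar≢0 = inj₂ (n≢0⇒n>0 ar≢0)

  result≤arguments : ∀ {o tin ts t} → Δ o tin ts t → Allᵛ (t ≤_) ts
  result≤arguments {o} {tin} {ts} {t} δ with nullary⊎hasArguments o
  ... | inj₁ ar≡0 = noArguments ts ar≡0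
    where
    noArguments : ∀ {n} (us : Vec ℕ n) → n ≡ 0 → Allᵛ (t ≤_) us
    noArguments [] _ = []
  ... | inj₂ 0<ar =
    let (t≤⋀ts , _) = proj₂ (proj₂ (safe o (tin , ts , t , δ) 0<ar)) tin ts t δ
    in  ⋀-lowerBound ts t≤⋀ts

  branchTyping : ∀ {c₁ c₀ t tin tout} (b : Bool) → TyC c₁ t tin tout → TyC c₀ t tin tout →
                 TyC (if b then c₁ else c₀) t tin tout
  branchTyping true  ty₁ _   = ty₁
  branchTyping false _   ty₀ = ty₀

  Agree : ℕ → Store → Store → Set
  Agree s μ ν = ∀ x → s ≤ Γ x → μ x ≡ ν x

  -- Non-interference

  module NonInterference {φ : Oracle} where
    open Loops {φ}

    eval-agree : ∀ {e t tin tout s μ ν a b} → TyE e t tin tout → s ≤ t → Agree s μ ν →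
                 EvalE φ μ e a → EvalE φ ν e b → a ≡ b
    evals-agree : ∀ {n} {es : Vec Exp n} {ts tin tout s μ ν as bs} →
                  TyEs es ts tin tout → Allᵛ (s ≤_) ts → Agree s μ ν →
                  EvalEs φ μ es as → EvalEs φ ν es bs → as ≡ bs
    eval-agree (tV {x = x}) s≤t agree (evar μx≡a) (evar νx≡b) =
      just-injective (trans (sym μx≡a) (trans (agree x s≤t) νx≡b))
    eval-agree (tOP {o = o} δ tys) s≤t agree (eop ds) (eop ds') =
      cong ⟦ o ⟧ (evals-agree tys (Allᵛ.map (≤-trans s≤t) (result≤arguments δ)) agree ds ds')
    eval-agree (tOR ty₁ ty₂ _ t≤tout) s≤t agree (eorc d₁ d₂) (eorc d₁' d₂') =
      cong₂ (λ v w → φ (restrict v w)) (eval-agree ty₁ s≤t agree d₁ d₁')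
                                        (eval-agree ty₂ (≤-trans s≤t t≤tout) agree d₂ d₂')
    evals-agree []           _          agree []       []         = refl
    evals-agree (ty ∷ tys) (s≤t ∷ s≤ts) agree (d ∷ ds) (d' ∷ ds') =
      cong₂ _∷_ (eval-agree ty s≤t agree d d') (evals-agree tys s≤ts agree ds ds')

    unchanged-above : ∀ {c u tin tout μ μ' x} → TyC c u tin tout → EvalC φ μ c μ' →
                      u < Γ x → μ' x ≡ μ x
    loop-unchanged-above : ∀ {e c u tout μ μ' x} → TyC c u u tout → Loop e c μ μ' →
                          u < Γ x → μ' x ≡ μ x
    unchanged-above (tSUB ty) d u<Γx = unchanged-above ty d (<-trans (n<1+n _) u<Γx)
    unchanged-above tSK cskip _ = refl
    unchanged-above {μ = μ} (tA (tV {x = y}) _ _) (cassign {w = w} _) u<Γx =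
      update-other μ w (λ x≡y → <-irrefl (cong Γ (sym x≡y)) u<Γx)
    unchanged-above (tS ty₁ ty₂) (cseq d₁ d₂) u<Γx =
      trans (unchanged-above ty₂ d₂ u<Γx) (unchanged-above ty₁ d₁ u<Γx)
    unchanged-above (tC _ ty₁ ty₀) (cif b _ d) u<Γx = unchanged-above (branchTyping b ty₁ ty₀) d u<Γx
    unchanged-above (tW _ ty _ _) r u<Γx = loop-unchanged-above ty r u<Γx
    unchanged-above (tW0 _ ty _) r u<Γx  = loop-unchanged-above ty r u<Γx
    loop-unchanged-above ty (cwhile0 _) _ = refl
    loop-unchanged-above ty (cwhile1 _ (cseq d r)) u<Γx =
      trans (loop-unchanged-above ty r u<Γx) (unchanged-above ty d u<Γx)

    exec-agree-above : ∀ {c u tin tout s μ ν μ' ν'} → TyC c u tin tout → u < s →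
                       Agree s μ ν → EvalC φ μ c μ' → EvalC φ ν c ν' → Agree s μ' ν'
    exec-agree-above ty u<s agree d d' x s≤Γx =
      let u<Γx = <-≤-trans u<s s≤Γx
      in  trans (unchanged-above ty d u<Γx) (trans (agree x s≤Γx) (sym (unchanged-above ty d' u<Γx)))

    exec-agree : ∀ {c u tin tout s μ ν μ' ν'} → TyC c u tin tout → Agree s μ ν →
                 EvalC φ μ c μ' → EvalC φ ν c ν' → Agree s μ' ν'
    loop-agree : ∀ {e c u tin tout tout' s μ ν μ' ν'} → TyE e u tin tout → TyC c u u tout' →
                 s ≤ u → Agree s μ ν → Loop e c μ μ' → Loop e c ν ν' → Agree s μ' ν'
    exec-agree (tSUB ty) agree d d' = exec-agree ty agree d d'
    exec-agree tSK agree cskip cskip = agree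
    exec-agree (tA (tV {x = y}) tye Γy≤t) agree (cassign d) (cassign d') x s≤Γx with x Fin.≟ y
    ... | yes refl = cong just (eval-agree tye (≤-trans s≤Γx Γy≤t) agree d d')
    ... | no _     = agree x s≤Γx
    exec-agree (tS ty₁ ty₂) agree (cseq d₁ d₂) (cseq d₁' d₂') =
      exec-agree ty₂ (exec-agree ty₁ agree d₁ d₁') d₂ d₂'
    exec-agree {s = s} ty@(tC {t = u} tye ty₁ ty₀) agree d@(cif b g db) d'@(cif b' g' db') with s ≤? u
    ... | no s≰u = exec-agree-above ty (≰⇒> s≰u) agree d d'
    ... | yes s≤u with bitW-injective (eval-agree tye s≤u agree g g')
    ...   | refl = exec-agree (branchTyping b ty₁ ty₀) agree db db'
    exec-agree {s = s} ty@(tW {t = u} tye tyc _ _) agree r r' with s ≤? u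
    ... | no s≰u  = exec-agree-above ty (≰⇒> s≰u) agree r r'
    ... | yes s≤u = loop-agree tye tyc s≤u agree r r'
    exec-agree {s = s} ty@(tW0 {t = u} tye tyc _) agree r r' with s ≤? u
    ... | no s≰u  = exec-agree-above ty (≰⇒> s≰u) agree r r'
    ... | yes s≤u = loop-agree tye tyc s≤u agree r r'
    loop-agree tye tyc s≤u agree (cwhile0 _) (cwhile0 _) = agree
    loop-agree tye tyc s≤u agree (cwhile0 g) (cwhile1 g' _) with eval-agree tye s≤u agree g g'
    ... | ()
    loop-agree tye tyc s≤u agree (cwhile1 g _) (cwhile0 g') with eval-agree tye s≤u agree g g'
    ... | ()
    loop-agree tye tyc s≤u agree (cwhile1 _ (cseq d r)) (cwhile1 _ (cseq d' r')) =
      loop-agree tye tyc s≤u (exec-agree tyc agree d d') r r'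

    iterations-agree : ∀ {e c u tin tout tout' μ ν μ' ν'} → TyE e u tin tout → TyC c u u tout' →
                       Agree u μ ν → (r : Loop e c μ μ') (r' : Loop e c ν ν') →
                       iterations r ≡ iterations r'
    iterations-agree tye tyc agree (cwhile0 _) (cwhile0 _) = refl
    iterations-agree tye tyc agree (cwhile0 g) (cwhile1 g' _) with eval-agree tye ≤-refl agree g g'
    ... | ()
    iterations-agree tye tyc agree (cwhile1 g _) (cwhile0 g') with eval-agree tye ≤-refl agree g g'
    ... | ()
    iterations-agree tye tyc agree (cwhile1 _ (cseq d r)) (cwhile1 _ (cseq d' r')) =
      cong suc (iterations-agree tye tyc (exec-agree tyc agree d d') r r')

    -- agreeing heads would have equally many remaining iterations
    heads-disagree : ∀ {e c u tin tout tout' μ μ'} → TyE e u tin tout → TyC c u u tout' →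
                     (r : Loop e c μ μ') → ∀ {i j} → i Fin.< j →
                     ¬ Agree u (headAt r i) (headAt r j)
    heads-disagree tye tyc r {i} {j} i<j agree = <-irrefl sameIndex i<j
      where
      sameIndex : toℕ i ≡ toℕ j
      sameIndex = +-cancelʳ-≡ _ (toℕ i) (toℕ j) (begin
        toℕ i + iterations (proj₂ (suffix r i)) ≡⟨ iterations-suffix r i ⟩
        iterations r                            ≡⟨ iterations-suffix r j ⟨
        toℕ j + iterations (proj₂ (suffix r j)) ≡⟨ cong (toℕ j +_) (iterations-agree tye tyc agree
                                                     (proj₂ (suffix r i)) (proj₂ (suffix r j))) ⟨
        toℕ j + iterations (proj₂ (suffix r i)) ∎)
        where open ≡-Reasoning

  nullaryValue : (n : ℕ) → (Vec W n → W) → List W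
  nullaryValue zero    f = f [] ∷ []
  nullaryValue (suc n) f = []

  ∈-nullaryValue : ∀ n f (ws : Vec W n) → n ≡ 0 → f ws ∈ nullaryValue n f
  ∈-nullaryValue zero f [] _ = here refl

  constantsE : Exp → List W
  constantsEs : ∀ {n} → Vec Exp n → List W
  constantsE (var x)   = []
  constantsE (op o es) = nullaryValue (ar o) ⟦ o ⟧ ++ constantsEs es
  constantsE (orc a b) = constantsE a ++ constantsE b
  constantsEs []       = []
  constantsEs (e ∷ es) = constantsE e ++ constantsEs es

  constantsC : Cmd → List W
  constantsC skip           = []
  constantsC (x := e)       = constantsE e
  constantsC (c₁ ⨾ c₂)      = constantsC c₁ ++ constantsC c₂
  constantsC (ifte e c₁ c₀) = constantsE e ++ constantsC c₁ ++ constantsC c₀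
  constantsC (while e c)    = constantsE e ++ constantsC c

  bits : List W
  bits = bitW false ∷ bitW true ∷ []

  FactorClosed : List W → Set
  FactorClosed F = ∀ {u v} → u ⊴ v → v ∈ F → u ∈ F

  StoreIn : ℕ → List W → Store → Set
  StoreIn s F μ = ∀ {x v} → s ≤ Γ x → μ x ≡ just v → v ∈ F

  module Closure {φ : Oracle} (F : List W) (closed : FactorClosed F) (bits⊆F : bits ⊆ F) where

    neutral-value∈ : ∀ {o} {ws : Vec W (ar o)} → 0 < ar o → Neutral o →
                     Allᵛ (_∈ F) ws → ⟦ o ⟧ ws ∈ F
    neutral-value∈ 0<ar (inj₁ ar≡0) _ = contradiction ar≡0 (n>0⇒n≢0 0<ar)
    neutral-value∈ {ws = ws} _ (inj₂ (inj₁ boolean)) _ with boolean ws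
    ... | inj₁ o≡0 = subst (_∈ F) (sym o≡0) (bits⊆F (here refl))
    ... | inj₂ o≡1 = subst (_∈ F) (sym o≡1) (bits⊆F (there (here refl)))
    neutral-value∈ {ws = ws} _ (inj₂ (inj₂ factor)) args =
      let (i , o⊴wsᵢ) = factor ws in closed o⊴wsᵢ (lookup⁺ args i)

    -- Above the tier tin no oracle is called, and every operator is neutral.
    value∈ : ∀ {e t tin tout s μ w} → TyE e t tin tout → tin ≤ t → s ≤ t → StoreIn s F μ →
             constantsE e ⊆ F → EvalE φ μ e w → w ∈ F
    values∈ : ∀ {n} {es : Vec Exp n} {ts tin tout s μ ws} → TyEs es ts tin tout →
              Allᵛ (tin ≤_) ts → Allᵛ (s ≤_) ts → StoreIn s F μ →
              constantsEs es ⊆ F → EvalEs φ μ es ws → Allᵛ (_∈ F) ws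
    value∈ tV _ s≤t inF _ (evar μx≡w) = inF s≤t μx≡w
    value∈ {t = t} {tin} (tOP {o = o} {es = es} {ts = ts} δ tys) tin≤t s≤t inF consts (eop {ws = ws} ds)
      with nullary⊎hasArguments o
    ... | inj₁ ar≡0 = consts (∈-++⁺ˡ (∈-nullaryValue (ar o) ⟦ o ⟧ ws ar≡0))
    ... | inj₂ 0<ar with safe o (tin , ts , t , δ) 0<ar
    ...   | kind , _ , tiers = result∈ kind
      where
      args : Allᵛ (_∈ F) ws
      args = values∈ tys (Allᵛ.map (≤-trans tin≤t) (result≤arguments δ))
               (Allᵛ.map (≤-trans s≤t) (result≤arguments δ)) inF
               (consts ∘ ∈-++⁺ʳ (nullaryValue (ar o) ⟦ o ⟧)) ds
      -- safety only refutes non-neutrality (it would force t < tin): argue by double negation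
      result∈ : Neutral o ⊎ Positive o → ⟦ o ⟧ ws ∈ F
      result∈ (inj₁ neutral)  = neutral-value∈ 0<ar neutral args
      result∈ (inj₂ positive) = decidable-stable (⟦ o ⟧ ws ∈? F) λ ∉F →
        let (_ , _ , _ , positive⇒t<tin) = tiers tin ts t δ
        in  ≤⇒≯ tin≤t (positive⇒t<tin positive λ neutral →
                         ∉F (neutral-value∈ 0<ar neutral args))
    value∈ (tOR _ _ t<tin _) tin≤t _ _ _ _ = contradiction tin≤t (<⇒≱ t<tin)
    values∈ [] [] [] _ _ [] = []
    values∈ {es = e ∷ es} (ty ∷ tys) (tin≤t ∷ tin≤ts) (s≤t ∷ s≤ts) inF consts (d ∷ ds) =
      value∈ ty tin≤t s≤t inF (consts ∘ ∈-++⁺ˡ) d ∷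
      values∈ tys tin≤ts s≤ts inF (consts ∘ ∈-++⁺ʳ (constantsE e)) ds

    exec-storeIn : ∀ {c u tin tout s μ μ'} → TyC c u tin tout → u ≤ s → tin ≤ s →
                   StoreIn s F μ → constantsC c ⊆ F → EvalC φ μ c μ' → StoreIn s F μ'
    loop-storeIn : ∀ {e c u tout s μ μ'} → TyC c u u tout → u ≤ s → StoreIn s F μ →
                   constantsC c ⊆ F → EvalC φ μ (while e c) μ' → StoreIn s F μ'
    exec-storeIn (tSUB ty) 1+u≤s tin≤s inF consts d =
      exec-storeIn ty (≤-trans (n≤1+n _) 1+u≤s) tin≤s inF consts d
    exec-storeIn tSK _ _ inF _ cskip = inF
    exec-storeIn (tA (tV {x = y}) tye Γy≤t) _ tin≤s inF consts (cassign d) {x} s≤Γx μ'x≡v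
      with x Fin.≟ y
    ... | yes refl = subst (_∈ F) (just-injective μ'x≡v)
                       (value∈ tye (≤-trans tin≤s s≤t) s≤t inF consts d)
      where s≤t = ≤-trans s≤Γx Γy≤t
    ... | no _     = inF s≤Γx μ'x≡v
    exec-storeIn (tS {c₁ = c₁} ty₁ ty₂) u≤s tin≤s inF consts (cseq d₁ d₂) =
      exec-storeIn ty₂ u≤s tin≤s
        (exec-storeIn ty₁ u≤s tin≤s inF (consts ∘ ∈-++⁺ˡ) d₁)
        (consts ∘ ∈-++⁺ʳ (constantsC c₁)) d₂
    exec-storeIn (tC {e = e} {c₁ = c₁} _ ty₁ _) u≤s tin≤s inF consts (cif true _ d) =
      exec-storeIn ty₁ u≤s tin≤s inF
        (consts ∘ ∈-++⁺ʳ (constantsE e) ∘ ∈-++⁺ˡ) d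
    exec-storeIn (tC {e = e} {c₁ = c₁} _ _ ty₀) u≤s tin≤s inF consts (cif false _ d) =
      exec-storeIn ty₀ u≤s tin≤s inF
        (consts ∘ ∈-++⁺ʳ (constantsE e) ∘ ∈-++⁺ʳ (constantsC c₁)) d
    exec-storeIn (tW {e = e} _ ty _ _) u≤s _ inF consts r =
      loop-storeIn ty u≤s inF (consts ∘ ∈-++⁺ʳ (constantsE e)) r
    exec-storeIn (tW0 {e = e} _ ty _) u≤s _ inF consts r =
      loop-storeIn ty u≤s inF (consts ∘ ∈-++⁺ʳ (constantsE e)) r
    loop-storeIn ty u≤s inF consts (cwhile0 _) = inF
    loop-storeIn ty u≤s inF consts (cwhile1 _ (cseq d r)) =
      loop-storeIn ty u≤s (exec-storeIn ty u≤s u≤s inF consts d) consts r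

  -- Counting loop iterations

  above : ℕ → Store → Store
  above s μ x with s ≤? Γ x
  ... | yes _ = μ x
  ... | no  _ = nothing

  above-visible : ∀ {s μ x} → s ≤ Γ x → above s μ x ≡ μ x
  above-visible {s} {μ} {x} s≤Γx with s ≤? Γ x
  ... | yes _   = refl
  ... | no s≰Γx = contradiction s≤Γx s≰Γx

  above-just : ∀ {s μ x v} → above s μ x ≡ just v → s ≤ Γ x × μ x ≡ just v
  above-just {s} {μ} {x} eq with s ≤? Γ x
  ... | yes s≤Γx = s≤Γx , eq

  module Counting {φ : Oracle} where
    open Loops {φ}
    open NonInterference {φ}

    -- Pigeonhole: the heads' tier-u parts are pairwise distinct functions Var → candidates.
    iterations-bound : ∀ {e c u tin tout tout' μ μ'} (F : List W) →
                       TyE e u tin tout → TyC c u u tout' → (r : Loop e c μ μ') →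
                       AllHeads (StoreIn u F) r → suc (iterations r) ≤ suc (length F) ^ nV
    iterations-bound {u = u} F tye tyc r inF with suc (iterations r) ≤? suc (length F) ^ nV
    ... | yes bound = bound
    ... | no ¬bound =
      let (i , j , i<j , codes≡) = pigeonhole-→ tooMany (λ i → code (inF i))
      in  contradiction (λ x → decode (inF i) (inF j) (codes≡ x)) (heads-disagree tye tyc r i<j)
      where
      candidates : List (Maybe W)
      candidates = nothing ∷ map just F

      tooMany : length candidates ^ nV < suc (iterations r)
      tooMany = subst (λ n → suc n ^ nV < _) (sym (length-map just F)) (≰⇒> ¬bound)

      candidate : ∀ {ν} → StoreIn u F ν → ∀ x → above u ν x ∈ candidates
      candidate {ν} inFν x with above u ν x in eq
      ... | nothing = here refl
      ... | just v  = let (u≤Γx , νx≡v) = above-just eq in there (∈-map⁺ just (inFν u≤Γx νx≡v))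

      code : ∀ {ν} → StoreIn u F ν → Var → Fin (length candidates)
      code inFν x = Any.index (candidate inFν x)

      decode : ∀ {ν ν' x} (inFν : StoreIn u F ν) (inFν' : StoreIn u F ν') →
               code inFν x ≡ code inFν' x → u ≤ Γ x → ν x ≡ ν' x
      decode {ν} {ν'} {x} inFν inFν' codes≡ u≤Γx = begin
        ν x                                        ≡⟨ above-visible u≤Γx ⟨
        above u ν x                                ≡⟨ lookup-index (candidate inFν x) ⟩
        List.lookup candidates (code inFν x)       ≡⟨ cong (List.lookup candidates) codes≡ ⟩
        List.lookup candidates (code inFν' x)      ≡⟨ lookup-index (candidate inFν' x) ⟨
        above u ν' x                               ≡⟨ above-visible u≤Γx ⟩
        ν' x                                       ∎
        where open ≡-Reasoning

  -- hidden variables contribute the junk value ε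
  valuesAbove : ℕ → Store → List W
  valuesAbove s μ = map (fromMaybe [] ∘ above s μ) (allFin nV)

  ∈-valuesAbove : ∀ {s μ x v} → s ≤ Γ x → μ x ≡ just v → v ∈ valuesAbove s μ
  ∈-valuesAbove {s} {μ} {x} s≤Γx μx≡v =
    subst (_∈ _) (cong (fromMaybe []) (trans (above-visible s≤Γx) μx≡v))
      (∈-map⁺ (fromMaybe [] ∘ above s μ) (∈-allFin x))

  valuesAbove-lengthsBelow : ∀ {s μ b} → (∀ {x v} → s ≤ Γ x → μ x ≡ just v → length v ≤ b) →
                             LengthsBelow b (valuesAbove s μ)
  valuesAbove-lengthsBelow {s} {μ} short w∈ with ∈-map⁻ (fromMaybe [] ∘ above s μ) w∈
  ... | x , _ , refl with above s μ x in eq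
  ...   | nothing = z≤n
  ...   | just v  = let (s≤Γx , μx≡v) = above-just eq in short s≤Γx μx≡v

  length-valuesAbove : ∀ s μ → length (valuesAbove s μ) ≡ nV
  length-valuesAbove s μ = trans (length-map _ (allFin nV)) (length-tabulate id)

  -- B will bound the oracle answers and K the program constants.
  module Norm (B K : ℕ) where

    opaque
      N : ℕ → Store → ℕ
      N s μ = max (B ⊔ K) (map length (valuesAbove s μ))

    opaque
      unfolding N

      N-B : ∀ s μ → B ≤ N s μ
      N-B s μ = v≤max⁺ _ (map length (valuesAbove s μ)) (inj₁ (m≤m⊔n B K))

      N-K : ∀ s μ → K ≤ N s μ
      N-K s μ = v≤max⁺ _ (map length (valuesAbove s μ)) (inj₁ (m≤n⊔m B K))

      valuesAbove-short : ∀ {s μ} → LengthsBelow (N s μ) (valuesAbove s μ)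
      valuesAbove-short {s} {μ} w∈ =
        All.lookup (xs≤max _ (map length (valuesAbove s μ))) (∈-map⁺ length w∈)

      N-var : ∀ {s μ x v} → s ≤ Γ x → μ x ≡ just v → length v ≤ N s μ
      N-var {s} {μ} s≤Γx μx≡v = valuesAbove-short {s} {μ} (∈-valuesAbove s≤Γx μx≡v)

      N-lub : ∀ {s μ b} → B ≤ b → K ≤ b →
              (∀ {x v} → s ≤ Γ x → μ x ≡ just v → length v ≤ b) → N s μ ≤ b
      N-lub {s} {μ} B≤b K≤b short = max≤v⁺ (⊔-lub B≤b K≤b) (All.tabulate λ ℓ∈ →
        let (w , w∈ , ℓ≡) = ∈-map⁻ length ℓ∈
        in  subst (_≤ _) (sym ℓ≡) (valuesAbove-lengthsBelow {s} {μ} short w∈))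

    N-anti : ∀ {s s' μ} → s ≤ s' → N s' μ ≤ N s μ
    N-anti {s} {s'} {μ} s≤s' = N-lub (N-B s μ) (N-K s μ) (λ s'≤Γx → N-var (≤-trans s≤s' s'≤Γx))

    N-update : ∀ {s μ x w b} → (s ≤ Γ x → length w ≤ b) → N s μ ≤ b → N s (μ [ x ← w ]) ≤ b
    N-update {s} {μ} {x} {w} {b} w-short N≤b =
      N-lub (≤-trans (N-B s μ) N≤b) (≤-trans (N-K s μ) N≤b) short
      where
      short : ∀ {y v} → s ≤ Γ y → (μ [ x ← w ]) y ≡ just v → length v ≤ b
      short {y} s≤Γy eq with y Fin.≟ x
      ... | yes refl = subst (λ v → length v ≤ b) (just-injective eq) (w-short s≤Γy)
      ... | no _     = ≤-trans (N-var s≤Γy eq) N≤b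

  -- Length and size bounds

  length-lookup≤maxLen : ∀ {n} (ws : Vec W n) i → length (Vec.lookup ws i) ≤ maxLen ws
  length-lookup≤maxLen (w ∷ ws) zero    = m≤m⊔n _ _
  length-lookup≤maxLen (w ∷ ws) (suc i) = ≤-trans (length-lookup≤maxLen ws i) (m≤n⊔m _ _)

  opExcess : ∀ {o tin ts t} → Δ o tin ts t → ℕ
  opExcess {o} {tin} {ts} {t} δ with nullary⊎hasArguments o
  ... | inj₁ _ = 0
  ... | inj₂ 0<ar with proj₁ (safe o (tin , ts , t , δ) 0<ar)
  ...   | inj₁ _       = 0
  ...   | inj₂ (c , _) = c

  op-length : ∀ {o tin ts t b} (δ : Δ o tin ts t) (ws : Vec W (ar o)) →
              (ar o ≡ 0 → length (⟦ o ⟧ ws) ≤ b) → 1 ≤ b → maxLen ws ≤ b →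
              length (⟦ o ⟧ ws) ≤ b + opExcess δ
  op-length {o} {tin} {ts} {t} {b} δ ws nullary 1≤b args≤b with nullary⊎hasArguments o
  ... | inj₁ ar≡0 = ≤-trans (nullary ar≡0) (m≤m+n b 0)
  ... | inj₂ 0<ar with proj₁ (safe o (tin , ts , t , δ) 0<ar)
  ...   | inj₁ (inj₁ ar≡0)  = contradiction ar≡0 (n>0⇒n≢0 0<ar)
  ...   | inj₁ (inj₂ (inj₁ boolean)) =
    ≤-trans (≤-reflexive ([ cong length , cong length ]′ (boolean ws))) (≤-trans 1≤b (m≤m+n b 0))
  ...   | inj₁ (inj₂ (inj₂ factor)) =
    let (i , o⊴wsᵢ) = factor ws
    in  ≤-trans (⊴-length o⊴wsᵢ)
                (≤-trans (length-lookup≤maxLen ws i) (≤-trans args≤b (m≤m+n b 0)))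
  ...   | inj₂ (c , bounded) = ≤-trans (bounded ws) (+-monoˡ-≤ c args≤b)

  excessE : ∀ {e t tin tout} → TyE e t tin tout → ℕ
  excessEs : ∀ {n} {es : Vec Exp n} {ts tin tout} → TyEs es ts tin tout → ℕ
  excessE tV            = 0
  excessE (tOP δ tys)   = excessEs tys + opExcess δ
  excessE (tOR _ _ _ _) = 0
  excessEs []           = 0
  excessEs (ty ∷ tys)   = excessE ty + excessEs tys

  -- (1 + |seeds| (1 + x)²)^nV, seeds being the visible values, n constants and two bits
  countBound : ℕ → PolyTerm
  countBound n = (con 1 ⊕ con (nV + (n + 2)) ⊗ ((con 1 ⊕ X) ⊗ (con 1 ⊕ X))) ^ₚ nV

  constantCount : Exp → Cmd → ℕ
  constantCount e c = length (constantsC (while e c))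

  loopGrowth : (ℕ → PolyTerm) → PolyTerm → ℕ → ℕ → PolyTerm
  loopGrowth G C zero    s = con 0
  loopGrowth G C (suc f) s = C ⊗ (G s ⊚ (X ⊕ loopGrowth G C f (suc s)))

  growth : ∀ {c u tin tout} → TyC c u tin tout → ℕ → PolyTerm
  growth (tSUB ty)    s = growth ty s
  growth tSK          s = con 0
  growth (tA _ tye _) s = con (excessE tye)
  growth (tS ty₁ ty₂) s = growth ty₁ s ⊕ growth ty₂ s ⊚ (X ⊕ growth ty₁ (suc s))
  growth (tC _ ty₁ ty₀) s = growth ty₁ s ⊕ growth ty₀ s
  growth (tW {e = e} {c} {u} _ tyc _ _) s = loopGrowth (growth tyc) (countBound (constantCount e c)) (u ∸ s) s
  growth (tW0 {e = e} {c} {u} _ tyc _) s  = loopGrowth (growth tyc) (countBound (constantCount e c)) (u ∸ s) s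

  sizeBound : ∀ {c u tin tout} → TyC c u tin tout → PolyTerm
  sizeBound (tSUB ty) = sizeBound ty
  sizeBound tSK       = con 1
  sizeBound (tA {e = e} _ _ _) = con (suc (expSize e))
  sizeBound (tS ty₁ ty₂) = con 1 ⊕ sizeBound ty₁ ⊕ sizeBound ty₂ ⊚ (X ⊕ growth ty₁ 0)
  sizeBound (tC {e = e} _ ty₁ ty₀) = con (suc (expSize e)) ⊕ sizeBound ty₁ ⊕ sizeBound ty₀
  sizeBound ty@(tW {e = e} {c} _ tyc _ _) =
    countBound (constantCount e c) ⊗ (con (2 + expSize e) ⊕ sizeBound tyc ⊚ (X ⊕ growth ty 0))
  sizeBound ty@(tW0 {e = e} {c} _ tyc _) =
    countBound (constantCount e c) ⊗ (con (2 + expSize e) ⊕ sizeBound tyc ⊚ (X ⊕ growth ty 0))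

  module Lengths {φ : Oracle} (B K : ℕ) (1≤K : 1 ≤ K) where
    open Norm B K
    open Loops {φ}
    open Counting {φ}

    eval-length : ∀ {e t tin tout μ w} (ty : TyE e t tin tout) (d : EvalE φ μ e w) → orE d ≤ B →
                  LengthsBelow K (constantsE e) → length w ≤ N t μ + excessE ty
    evals-length : ∀ {n} {es : Vec Exp n} {ts tin tout μ ws t} (tys : TyEs es ts tin tout)
                   (ds : EvalEs φ μ es ws) → orEs ds ≤ B → LengthsBelow K (constantsEs es) →
                   Allᵛ (t ≤_) ts → maxLen ws ≤ N t μ + excessEs tys
    eval-length tV (evar μx≡w) _ _ = ≤-trans (N-var ≤-refl μx≡w) (m≤m+n _ _)
    eval-length {t = t} {μ = μ} (tOP {o = o} {es = es} δ tys) (eop {ws = ws} ds) ob short =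
      ≤-trans (op-length δ ws nullary (≤-trans 1≤K (≤-trans (N-K t μ) (m≤m+n _ _)))
                 (evals-length tys ds ob (short ∘ ∈-++⁺ʳ _) (result≤arguments δ)))
              (≤-reflexive (+-assoc (N t μ) (excessEs tys) (opExcess δ)))
      where
      nullary : ar o ≡ 0 → length (⟦ o ⟧ ws) ≤ N t μ + excessEs tys
      nullary ar≡0 = ≤-trans (short (∈-++⁺ˡ (∈-nullaryValue (ar o) ⟦ o ⟧ ws ar≡0)))
                             (≤-trans (N-K t μ) (m≤m+n _ _))
    eval-length {t = t} {μ = μ} (tOR _ _ _ _) (eorc _ _) ob _ =
      ≤-trans (m≤m⊔n _ _) (≤-trans ob (≤-trans (N-B t μ) (m≤m+n _ _)))
    evals-length [] [] _ _ [] = z≤n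
    evals-length {es = e ∷ _} {μ = μ} {t = t} (ty ∷ tys) (d ∷ ds) ob short (t≤t₁ ∷ t≤ts) =
      ⊔-lub (≤-trans (eval-length ty d (≤-trans (m≤m⊔n _ _) ob) (short ∘ ∈-++⁺ˡ))
                     (+-mono-≤ (N-anti t≤t₁) (m≤m+n _ _)))
            (≤-trans (evals-length tys ds (≤-trans (m≤n⊔m _ _) ob)
                                   (short ∘ ∈-++⁺ʳ (constantsE e)) t≤ts)
                     (+-monoʳ-≤ (N t μ) (m≤n+m _ _)))

    seeds : ℕ → Store → List W → List W
    seeds s μ xs = valuesAbove s μ ++ xs ++ bits

    seeds-storeIn : ∀ {s μ} xs → StoreIn s (factorsOf (seeds s μ xs)) μ
    seeds-storeIn xs s≤Γx μx≡v = ∈-factorsOf⁺ (⊴-refl _) (∈-++⁺ˡ (∈-valuesAbove s≤Γx μx≡v))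

    seeds-⊇ : ∀ {s μ} xs → xs ⊆ factorsOf (seeds s μ xs)
    seeds-⊇ {s} {μ} xs x∈ = ∈-factorsOf⁺ (⊴-refl _) (∈-++⁺ʳ (valuesAbove s μ) (∈-++⁺ˡ x∈))

    seeds-bits : ∀ {s μ} xs → bits ⊆ factorsOf (seeds s μ xs)
    seeds-bits {s} {μ} xs b∈ =
      ∈-factorsOf⁺ (⊴-refl _) (∈-++⁺ʳ (valuesAbove s μ) (∈-++⁺ʳ xs b∈))

    seeds-short : ∀ {s μ xs} → LengthsBelow K xs → LengthsBelow (N s μ) (seeds s μ xs)
    seeds-short {s} {μ} {xs} short w∈ with ∈-++⁻ (valuesAbove s μ) w∈
    ... | inj₁ w∈values = valuesAbove-short w∈values
    ... | inj₂ w∈rest with ∈-++⁻ xs w∈rest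
    ...   | inj₁ w∈xs = ≤-trans (short w∈xs) (N-K s μ)
    ...   | inj₂ (here refl)         = ≤-trans 1≤K (N-K s μ)
    ...   | inj₂ (there (here refl)) = ≤-trans 1≤K (N-K s μ)

    length-seeds : ∀ s μ xs → length (seeds s μ xs) ≡ nV + (length xs + 2)
    length-seeds s μ xs = begin
      length (valuesAbove s μ ++ xs ++ bits)         ≡⟨ length-++ (valuesAbove s μ) ⟩
      length (valuesAbove s μ) + length (xs ++ bits) ≡⟨ cong₂ _+_ (length-valuesAbove s μ)
                                                                  (length-++ xs) ⟩
      nV + (length xs + 2)                           ∎
      where open ≡-Reasoning

    eval-length-tame : ∀ {e t tin tout μ w} → TyE e t tin tout → tin ≤ t →
                       LengthsBelow K (constantsE e) → EvalE φ μ e w → length w ≤ N t μ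
    eval-length-tame {e} {t} {μ = μ} ty tin≤t short d =
      factorsOf-lengthsBelow S (seeds-short short)
        (value∈ ty tin≤t ≤-refl (seeds-storeIn (constantsE e)) (seeds-⊇ {t} {μ} (constantsE e)) d)
      where
      S = seeds t μ (constantsE e)
      open Closure {φ} (factorsOf S) (factorsOf-⊴-closed S) (seeds-bits {t} {μ} (constantsE e))

    iterations-≤count : ∀ {e c u tin tout tout' μ μ'} → TyE e u tin tout → TyC c u u tout' →
                        LengthsBelow K (constantsC (while e c)) → (r : Loop e c μ μ') →
                        suc (iterations r) ≤ ⟦ countBound (constantCount e c) ⟧ₚ (N u μ)
    iterations-≤count {e} {c} {u} {μ = μ} tye tyc short r = begin
      suc (iterations r)                  ≤⟨ iterations-bound F tye tyc r inF ⟩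
      suc (length F) ^ nV                 ≤⟨ ^-monoˡ-≤ nV (s≤s (length-factorsOf S (seeds-short short))) ⟩
      suc (length S * (suc x * suc x)) ^ nV ≡⟨ cong (λ n → suc (n * (suc x * suc x)) ^ nV)
                                                (length-seeds u μ (constantsC (while e c))) ⟩
      suc ((nV + (n + 2)) * (suc x * suc x)) ^ nV ≡⟨ ⟦^ₚ⟧ _ nV x ⟨
      ⟦ countBound n ⟧ₚ x                 ∎
      where
      open ≤-Reasoning
      n = constantCount e c
      x = N u μ
      xs = constantsC (while e c)
      S = seeds u μ xs
      F = factorsOf S
      open Closure {φ} F (factorsOf-⊴-closed S) (seeds-bits {u} {μ} xs)
      inF : AllHeads (StoreIn u F) r
      inF = heads-invariant (StoreIn u F)
              (λ d inFν → exec-storeIn tyc ≤-refl ≤-refl inFν (seeds-⊇ {u} {μ} xs ∘ ∈-++⁺ʳ (constantsE e)) d)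
              r (seeds-storeIn xs)

    exec-N-nonincreasing : ∀ {c u tin tout s μ μ'} → TyC c u tin tout → LengthsBelow K (constantsC c) →
                           EvalC φ μ c μ' → u ⊔ tin ≤ s → N s μ' ≤ N s μ
    loop-N-nonincreasing : ∀ {e c u tout s μ μ'} → TyC c u u tout → LengthsBelow K (constantsC c) →
                           Loop e c μ μ' → u ≤ s → N s μ' ≤ N s μ
    exec-N-nonincreasing {tin = tin} (tSUB ty) short d u⊔tin≤s =
      exec-N-nonincreasing ty short d (≤-trans (⊔-monoˡ-≤ tin (n≤1+n _)) u⊔tin≤s)
    exec-N-nonincreasing tSK _ cskip _ = ≤-refl
    exec-N-nonincreasing {tin = tin} (tA (tV {x = y}) tye Γy≤t) short (cassign d) Γy⊔tin≤s =
      N-update (λ s≤Γy → ≤-trans (eval-length-tame tye (tin≤t s≤Γy) short d)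
                                 (N-anti (≤-trans s≤Γy Γy≤t)))
               ≤-refl
      where
      tin≤t = λ s≤Γy → ≤-trans (m≤n⊔m (Γ y) tin) (≤-trans Γy⊔tin≤s (≤-trans s≤Γy Γy≤t))
    exec-N-nonincreasing (tS {c₁ = c₁} ty₁ ty₂) short (cseq d₁ d₂) le =
      ≤-trans (exec-N-nonincreasing ty₂ (short ∘ ∈-++⁺ʳ (constantsC c₁)) d₂ le)
              (exec-N-nonincreasing ty₁ (short ∘ ∈-++⁺ˡ) d₁ le)
    exec-N-nonincreasing (tC {e = e} _ ty₁ _) short (cif true _ d) le =
      exec-N-nonincreasing ty₁ (short ∘ ∈-++⁺ʳ (constantsE e) ∘ ∈-++⁺ˡ) d le
    exec-N-nonincreasing (tC {e = e} {c₁ = c₁} _ _ ty₀) short (cif false _ d) le =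
      exec-N-nonincreasing ty₀ (short ∘ ∈-++⁺ʳ (constantsE e) ∘ ∈-++⁺ʳ (constantsC c₁)) d le
    exec-N-nonincreasing {tin = tin} (tW {e = e} {t = u} _ tyc _ _) short r le =
      loop-N-nonincreasing tyc (short ∘ ∈-++⁺ʳ (constantsE e)) r (≤-trans (m≤m⊔n u tin) le)
    exec-N-nonincreasing {tin = tin} (tW0 {e = e} {t = u} _ tyc _) short r le =
      loop-N-nonincreasing tyc (short ∘ ∈-++⁺ʳ (constantsE e)) r (≤-trans (m≤m⊔n u tin) le)
    loop-N-nonincreasing tyc short (cwhile0 _) u≤s = ≤-refl
    loop-N-nonincreasing tyc short (cwhile1 _ (cseq d r)) u≤s =
      ≤-trans (loop-N-nonincreasing tyc short r u≤s) (exec-N-nonincreasing tyc short d (⊔-lub u≤s u≤s))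

    exec-N-growth : ∀ {c u tin tout μ μ'} (ty : TyC c u tin tout) → LengthsBelow K (constantsC c) →
                    (d : EvalC φ μ c μ') → orC d ≤ B →
                    ∀ s → N s μ' ≤ N s μ + ⟦ growth ty s ⟧ₚ (N (suc s) μ)
    loop-N-growth : ∀ {e c u tin tout tout' μ μ'} → TyE e u tin tout → (tyc : TyC c u u tout') →
                    LengthsBelow K (constantsC (while e c)) → (r : Loop e c μ μ') → orC r ≤ B →
                    ∀ f s → u ∸ s ≡ f →
                    AllHeads (λ ν → N s ν ≤ N s μ + ⟦ loopGrowth (growth tyc) (countBound (constantCount e c)) f s ⟧ₚ
                                                       (N (suc s) μ)) r
    exec-N-growth (tSUB ty) short d ob s = exec-N-growth ty short d ob s
    exec-N-growth tSK _ cskip _ s = m≤m+n _ _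
    exec-N-growth (tA (tV {x = y}) tye Γy≤t) short (cassign d) ob s =
      N-update (λ s≤Γy → ≤-trans (eval-length tye d ob short)
                                 (+-monoˡ-≤ _ (N-anti (≤-trans s≤Γy Γy≤t))))
               (m≤m+n _ _)
    exec-N-growth {μ = μ} {μ'} (tS {c₁ = c₁} {c₂} ty₁ ty₂) short (cseq {μ₁ = μ₁} d₁ d₂) ob s = begin
      N s μ'                                  ≤⟨ exec-N-growth ty₂ short₂ d₂ ob₂ s ⟩
      N s μ₁ + ⟦ G₂ ⟧ₚ (N (suc s) μ₁)         ≤⟨ +-mono-≤ (exec-N-growth ty₁ short₁ d₁ ob₁ s)
                                                         (⟦⟧ₚ-mono G₂ first-step) ⟩
      N s μ + ⟦ G₁ ⟧ₚ x + ⟦ G₂ ⟧ₚ (x + ⟦ G₁' ⟧ₚ x) ≡⟨ +-assoc (N s μ) _ _ ⟩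
      N s μ + ⟦ growth (tS ty₁ ty₂) s ⟧ₚ x     ∎
      where
      open ≤-Reasoning
      x = N (suc s) μ
      G₁ = growth ty₁ s
      G₁' = growth ty₁ (suc s)
      G₂ = growth ty₂ s
      short₁ : LengthsBelow K (constantsC c₁)
      short₁ = short ∘ ∈-++⁺ˡ
      short₂ : LengthsBelow K (constantsC c₂)
      short₂ = short ∘ ∈-++⁺ʳ (constantsC c₁)
      ob₁ = ≤-trans (m≤m⊔n (orC d₁) (orC d₂)) ob
      ob₂ = ≤-trans (m≤n⊔m (orC d₁) (orC d₂)) ob
      first-step : N (suc s) μ₁ ≤ x + ⟦ G₁' ⟧ₚ x
      first-step = ≤-trans (exec-N-growth ty₁ short₁ d₁ ob₁ (suc s))
                           (+-monoʳ-≤ x (⟦⟧ₚ-mono G₁' (N-anti (n≤1+n _))))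
    exec-N-growth {μ = μ} (tC {e = e} _ ty₁ ty₀) short (cif true g d) ob s =
      ≤-trans (exec-N-growth ty₁ (short ∘ ∈-++⁺ʳ (constantsE e) ∘ ∈-++⁺ˡ) d
                             (≤-trans (m≤n⊔m (orE g) _) ob) s)
              (+-monoʳ-≤ (N s μ) (m≤m+n _ _))
    exec-N-growth {μ = μ} (tC {e = e} {c₁ = c₁} _ ty₁ ty₀) short (cif false g d) ob s =
      ≤-trans (exec-N-growth ty₀ (short ∘ ∈-++⁺ʳ (constantsE e) ∘ ∈-++⁺ʳ (constantsC c₁)) d
                             (≤-trans (m≤n⊔m (orE g) _) ob) s)
              (+-monoʳ-≤ (N s μ) (m≤n+m _ _))
    exec-N-growth (tW {t = u} tye tyc _ _) short r ob s =
      subst (λ ν → N s ν ≤ _) (headAt-last r)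
            (loop-N-growth tye tyc short r ob (u ∸ s) s refl (fromℕ (iterations r)))
    exec-N-growth (tW0 {t = u} tye tyc _) short r ob s =
      subst (λ ν → N s ν ≤ _) (headAt-last r)
            (loop-N-growth tye tyc short r ob (u ∸ s) s refl (fromℕ (iterations r)))

    -- From the loop tier downwards: at tiers ≥ u the loop does not increase N s; below u
    -- each iteration adds at most the body's growth at the bound already found for s + 1.
    loop-N-growth {e} {c} {μ = μ} tye tyc short r ob zero s u∸s≡0 i =
      ≤-trans (heads-invariant (λ ν → N s ν ≤ N s μ) step r ≤-refl i) (m≤m+n _ _)
      where
      u≤s = m∸n≡0⇒m≤n u∸s≡0
      step : ∀ {ν ν'} → EvalC φ ν c ν' → N s ν ≤ N s μ → N s ν' ≤ N s μ
      step d N≤ = ≤-trans (exec-N-nonincreasing tyc (short ∘ ∈-++⁺ʳ (constantsE e)) d (⊔-lub u≤s u≤s))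
                          N≤
    loop-N-growth {e} {c} {u} {μ = μ} tye tyc short r ob (suc f) s u∸s≡1+f i = begin
      N s (headAt r i)        ≤⟨ heads-linear (λ ν → N (suc s) ν ≤ y) (N s) G step r ob below i ⟩
      N s μ + toℕ i * G       ≤⟨ +-monoʳ-≤ (N s μ) (*-monoˡ-≤ G i≤count) ⟩
      N s μ + ⟦ C ⟧ₚ x * G    ∎
      where
      open ≤-Reasoning
      C = countBound (constantCount e c)
      H = loopGrowth (growth tyc) C f (suc s)
      x = N (suc s) μ
      y = x + ⟦ H ⟧ₚ x
      G = ⟦ growth tyc s ⟧ₚ y
      s<u : s < u
      s<u = m∸n≢0⇒n<m (λ u∸s≡0 → 1+n≢0 (trans (sym u∸s≡1+f) u∸s≡0))
      below : AllHeads (λ ν → N (suc s) ν ≤ y) r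
      below j = ≤-trans (loop-N-growth tye tyc short r ob f (suc s)
                           (trans (sym (pred[m∸n]≡m∸[1+n] u s)) (cong pred u∸s≡1+f)) j)
                        (+-monoʳ-≤ x (⟦⟧ₚ-mono H (N-anti (n≤1+n _))))
      step : ∀ {ν ν'} (d : EvalC φ ν c ν') → orC d ≤ B → N (suc s) ν ≤ y → N s ν' ≤ N s ν + G
      step d ob-d N≤y = ≤-trans (exec-N-growth tyc (short ∘ ∈-++⁺ʳ (constantsE e)) d ob-d s)
                                (+-monoʳ-≤ _ (⟦⟧ₚ-mono (growth tyc s) N≤y))
      i≤count : toℕ i ≤ ⟦ C ⟧ₚ x
      i≤count = ≤-trans (toℕ≤pred[n] i)
                  (≤-trans (n≤1+n _) (≤-trans (iterations-≤count tye tyc short r)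
                                              (⟦⟧ₚ-mono C (N-anti s<u))))

    loop-size-≤ : ∀ {e c u tout μ μ'} (tyc : TyC c u u tout) → LengthsBelow K (constantsC c) →
                  (r : Loop e c μ μ') → orC r ≤ B → ∀ y → AllHeads (λ ν → N 0 ν ≤ y) r →
                  sizeC r ≤ suc (iterations r) * (2 + expSize e + ⟦ sizeBound tyc ⟧ₚ y)
    exec-size-≤ : ∀ {c u tin tout μ μ'} (ty : TyC c u tin tout) → LengthsBelow K (constantsC c) →
                  (d : EvalC φ μ c μ') → orC d ≤ B → sizeC d ≤ ⟦ sizeBound ty ⟧ₚ (N 0 μ)
    while-size-≤ : ∀ {e c u tin tout tout' μ μ'} → TyE e u tin tout → (tyc : TyC c u u tout') →
                   LengthsBelow K (constantsC (while e c)) → (r : Loop e c μ μ') → orC r ≤ B →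
                   let C = countBound (constantCount e c) in
                   sizeC r ≤ ⟦ C ⊗ (con (2 + expSize e) ⊕ sizeBound tyc ⊚ (X ⊕ loopGrowth (growth tyc) C u 0)) ⟧ₚ
                               (N 0 μ)

    loop-size-≤ {e} tyc short (cwhile0 g) ob y _ = begin
      suc (sizeE g)   ≡⟨ cong suc (sizeE≡expSize g) ⟩
      suc (expSize e) ≤⟨ ≤-trans (n≤1+n _) (m≤m+n _ _) ⟩
      M               ≡⟨ *-identityˡ M ⟨
      1 * M           ∎
      where
      open ≤-Reasoning
      M = 2 + expSize e + ⟦ sizeBound tyc ⟧ₚ y
    loop-size-≤ {e} tyc short (cwhile1 g (cseq d r)) ob y heads≤y = begin
      suc (sizeE g + suc (sizeC d + sizeC r)) ≡⟨ regroup (sizeE g) (sizeC d) (sizeC r) ⟩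
      2 + sizeE g + sizeC d + sizeC r         ≤⟨ +-mono-≤ (+-mono-≤ (≤-reflexive (cong (2 +_) (sizeE≡expSize g)))
                                                                  body≤)
                                                        (loop-size-≤ tyc short r (≤-trans (orC-rest≤ g d r) ob) y
                                                                     (heads≤y ∘ suc)) ⟩
      M + suc (iterations r) * M              ∎
      where
      open ≤-Reasoning
      M = 2 + expSize e + ⟦ sizeBound tyc ⟧ₚ y
      body≤ : sizeC d ≤ ⟦ sizeBound tyc ⟧ₚ y
      body≤ = ≤-trans (exec-size-≤ tyc short d (≤-trans (orC-body≤ g d r) ob))
                      (⟦⟧ₚ-mono (sizeBound tyc) (heads≤y zero))
      regroup : ∀ a b c → suc (a + suc (b + c)) ≡ 2 + a + b + c
      regroup = solve-∀

    exec-size-≤ (tSUB ty) short d ob = exec-size-≤ ty short d ob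
    exec-size-≤ tSK _ cskip _ = ≤-refl
    exec-size-≤ (tA _ _ _) _ (cassign d) _ = ≤-reflexive (cong suc (sizeE≡expSize d))
    exec-size-≤ {μ = μ} (tS {c₁ = c₁} ty₁ ty₂) short (cseq {μ₁ = μ₁} d₁ d₂) ob =
      s≤s (+-mono-≤ (exec-size-≤ ty₁ short₁ d₁ ob₁)
                    (≤-trans (exec-size-≤ ty₂ (short ∘ ∈-++⁺ʳ (constantsC c₁)) d₂ ob₂)
                             (⟦⟧ₚ-mono (sizeBound ty₂) first-step)))
      where
      x = N 0 μ
      short₁ : LengthsBelow K (constantsC c₁)
      short₁ = short ∘ ∈-++⁺ˡ
      ob₁ = ≤-trans (m≤m⊔n (orC d₁) (orC d₂)) ob
      ob₂ = ≤-trans (m≤n⊔m (orC d₁) (orC d₂)) ob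
      first-step : N 0 μ₁ ≤ x + ⟦ growth ty₁ 0 ⟧ₚ x
      first-step = ≤-trans (exec-N-growth ty₁ short₁ d₁ ob₁ 0)
                           (+-monoʳ-≤ x (⟦⟧ₚ-mono (growth ty₁ 0) (N-anti z≤n)))
    exec-size-≤ (tC {e = e} _ ty₁ _) short (cif true g d) ob =
      ≤-trans (s≤s (+-mono-≤ (≤-reflexive (sizeE≡expSize g))
                             (exec-size-≤ ty₁ (short ∘ ∈-++⁺ʳ (constantsE e) ∘ ∈-++⁺ˡ) d
                                          (≤-trans (m≤n⊔m (orE g) _) ob))))
              (m≤m+n _ _)
    exec-size-≤ (tC {e = e} {c₁ = c₁} _ _ ty₀) short (cif false g d) ob =
      s≤s (+-mono-≤ (≤-trans (≤-reflexive (sizeE≡expSize g)) (m≤m+n _ _))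
                    (exec-size-≤ ty₀ (short ∘ ∈-++⁺ʳ (constantsE e) ∘ ∈-++⁺ʳ (constantsC c₁)) d
                                 (≤-trans (m≤n⊔m (orE g) _) ob)))
    exec-size-≤ (tW tye tyc _ _) short r ob = while-size-≤ tye tyc short r ob
    exec-size-≤ (tW0 tye tyc _) short r ob  = while-size-≤ tye tyc short r ob

    while-size-≤ {e} {c} {u} {μ = μ} tye tyc short r ob = begin
      sizeC r                ≤⟨ loop-size-≤ tyc (short ∘ ∈-++⁺ʳ (constantsE e)) r ob y heads≤y ⟩
      suc (iterations r) * M ≤⟨ *-monoˡ-≤ M (≤-trans (iterations-≤count tye tyc short r)
                                                      (⟦⟧ₚ-mono C (N-anti z≤n))) ⟩
      ⟦ C ⟧ₚ x * M           ∎
      where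
      open ≤-Reasoning
      C = countBound (constantCount e c)
      H = loopGrowth (growth tyc) C u 0
      x = N 0 μ
      y = x + ⟦ H ⟧ₚ x
      M = 2 + expSize e + ⟦ sizeBound tyc ⟧ₚ y
      heads≤y : AllHeads (λ ν → N 0 ν ≤ y) r
      heads≤y i = ≤-trans (loop-N-growth tye tyc short r ob u 0 refl i)
                          (+-monoʳ-≤ x (⟦⟧ₚ-mono H (N-anti z≤n)))

  size-polynomial : ∀ {c u tin tout φ μ μ' K} (ty : TyC c u tin tout) → 1 ≤ K →
                    LengthsBelow K (constantsC c) → (d : EvalC φ μ c μ') →
                    sizeC d ≤ ⟦ sizeBound ty ⊚ (X ⊕ con K) ⟧ₚ (storeSize μ ⊔ orC d)
  size-polynomial {φ = φ} {μ} {K = K} ty 1≤K short d =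
    ≤-trans (exec-size-≤ ty short d ≤-refl) (⟦⟧ₚ-mono (sizeBound ty) N≤m+K)
    where
    open Norm (orC d) K
    open Lengths {φ} (orC d) K 1≤K
    m = storeSize μ ⊔ orC d
    N≤m+K : N 0 μ ≤ m + K
    N≤m+K = N-lub (≤-trans (m≤n⊔m (storeSize μ) _) (m≤m+n m K)) (m≤n+m K m)
                  (λ _ μx≡v → ≤-trans (length≤storeSize {μ} μx≡v)
                                      (≤-trans (m≤m⊔n _ _) (m≤m+n m K)))

corollary6p10 : (L : Lang) (PT : Sem.PolyTimePred L) (p : Sem.Prog L) →
    Sem.ST L PT p →
    ∃[ P ] (∀ (μ : Sem.Store L) (φ : Sem.Oracle L) (w : Sem.W L)
              (π : Sem.EvalP L φ μ p w) →
              Sem.sizeP L π ≤ evalPoly P (Sem.mP L π))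
corollary6p10 L PT p ((Γ , Δ , _ , _ , _ , safe , ty) , _) = toPoly P , bound
  where
  open Sem L
  open Analysis L {PT} Γ Δ safe
  K = suc (max 0 (map length (constantsC (body p))))
  short : LengthsBelow K (constantsC (body p))
  short w∈ = m≤n⇒m≤1+n (All.lookup (xs≤max 0 _) (∈-map⁺ length w∈))
  P = con 1 ⊕ sizeBound ty ⊚ (X ⊕ con K)
  bound : ∀ μ φ w (π : EvalP φ μ p w) → sizeP π ≤ evalPoly (toPoly P) (mP π)
  bound μ φ w π@(eprog d _) = ≤-trans (s≤s (size-polynomial ty (s≤s z≤n) short d))
                                      (≤-reflexive (sym (evalPoly-toPoly P (mP π))))
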